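{- Let $F$ be a finite field and let $s_1(X,Y)$, $s_2(X,Y)$ be binary quadratic forms over $F$ with no common factor and with $r(s_1,s_2)=2$. Then there are at least $\tfrac12(\#F-1)^2$ pairs $(a,b)\in F^2\setminus\{(0,0)\}$ for which $as_1+bs_2$ is a hyperbolic plane, and at least $\tfrac12(\#F-1)^2$ such pairs for which $as_1+bs_2$ is anisotropic of rank $2$.
   Context: A binary quadratic form $s=aX^2+bXY+cY^2$ over $F$ is a hyperbolic plane if some $T\in\mathrm{GL}_2(F)$ transforms it into $XY$; it is anisotropic of rank $2$ if it has rank $2$ and no non-trivial zero over $F$. The rank of a form is the least $m$ such that after some invertible linear change of variables it depends only on $m$ variables; $r(s_1,s_2)$ is the maximum of $\mathrm{rank}(as_1+bs_2)$ over $(a,b)\in\overline{F}^2\setminus\{0\}$. -}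

module Defs where

open import Level using (0ℓ)
open import Algebra.Bundles using (CommutativeRing)
open import Algebra.Morphism.Structures using (module RingMorphisms)
open import Data.Nat using (ℕ; zero; suc; _<_)
open import Data.Fin using (Fin)
open import Data.Product using (Σ; _×_; _,_; proj₁; proj₂)
open import Data.Sum using (_⊎_)
open import Data.Unit using (⊤)
open import Relation.Nullary using (¬_)
open import Relation.Binary.PropositionalEquality using (_≡_)
open import Function using (_∘_)

record Field : Set₁ where
  field
    commRing : CommutativeRing 0ℓ 0ℓ
  open CommutativeRing commRing public
  field
    0≉1 : ¬ (0# ≈ 1#)
    inverse : ∀ x → ¬ (x ≈ 0#) → Σ Carrier (λ y → (x * y) ≈ 1#)

record FiniteField : Set₁ where
  field
    field′ : Field
  open Field field′
  field
    card      : ℕ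
    enum      : Fin card → Carrier
    enum-inj  : ∀ i j → enum i ≈ enum j → i ≡ j
    enum-surj : ∀ x → Σ (Fin card) (λ i → enum i ≈ x)

record Extension (K L : Field) : Set where
  open RingMorphisms (Field.rawRing K) (Field.rawRing L)
  field
    ι     : Field.Carrier K → Field.Carrier L
    isHom : IsRingHomomorphism ι

module _ (K : Field) where
  open Field K

  record BinForm : Set where
    constructor form
    field
      cXX : Carrier
      cXY : Carrier
      cYY : Carrier
  open BinForm public

  _≈F_ : BinForm → BinForm → Set
  s ≈F t = (cXX s ≈ cXX t) × (cXY s ≈ cXY t) × (cYY s ≈ cYY t)

  eval : BinForm → Carrier → Carrier → Carrier
  eval s x y = cXX s * x * x + cXY s * x * y + cYY s * y * y

  lincomb : Carrier → BinForm → Carrier → BinForm → BinForm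
  lincomb a s₁ b s₂ = form (a * cXX s₁ + b * cXX s₂)
                           (a * cXY s₁ + b * cXY s₂)
                           (a * cYY s₁ + b * cYY s₂)

  -- linear change of variables X ↦ αX + βY, Y ↦ γX + δY
  subst : Carrier → Carrier → Carrier → Carrier → BinForm → BinForm
  subst α β γ δ s =
    form (cXX s * α * α + cXY s * α * γ + cYY s * γ * γ)
         ((cXX s * α * β + cXX s * α * β) + cXY s * (α * δ + β * γ)
            + (cYY s * γ * δ + cYY s * γ * δ))
         (cXX s * β * β + cXY s * β * δ + cYY s * δ * δ)

  Invertible : Carrier → Carrier → Carrier → Carrier → Set
  Invertible α β γ δ = ¬ ((α * δ - β * γ) ≈ 0#)

  IsHyperbolic : BinForm → Set
  IsHyperbolic s = Σ Carrier λ α → Σ Carrier λ β → Σ Carrier λ γ → Σ Carrier λ δ →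
    Invertible α β γ δ × (subst α β γ δ s ≈F form 0# 1# 0#)

  -- rank ≤ m : after some invertible change of variables s depends only on
  -- (at most) m of the variables X, Y
  RankAtMost : BinForm → ℕ → Set
  RankAtMost s zero = Σ Carrier λ α → Σ Carrier λ β → Σ Carrier λ γ → Σ Carrier λ δ →
    Invertible α β γ δ × (subst α β γ δ s ≈F form 0# 0# 0#)
  RankAtMost s (suc zero) = Σ Carrier λ α → Σ Carrier λ β → Σ Carrier λ γ → Σ Carrier λ δ →
    Invertible α β γ δ × ((cXY (subst α β γ δ s) ≈ 0#) × (cYY (subst α β γ δ s) ≈ 0#))
  RankAtMost s (suc (suc m)) = ⊤

  HasRank : BinForm → ℕ → Set
  HasRank s m = RankAtMost s m × (∀ k → k < m → ¬ RankAtMost s k)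

  IsAnisotropicRank2 : BinForm → Set
  IsAnisotropicRank2 s = HasRank s 2 ×
    (∀ x y → ¬ ((x ≈ 0#) × (y ≈ 0#)) → ¬ (eval s x y ≈ 0#))

  -- Factors of the
  -- nonzero homogeneous quadratics are homogeneous, so a common factor is
  -- a nonzero linear form ℓ = uX+vY with s_i = ℓ·(p_i X + q_i Y), or a
  -- nonzero quadratic form g with s_i = k_i·g.
  CommonFactor : BinForm → BinForm → Set
  CommonFactor s₁ s₂ = LinearCommon ⊎ QuadraticCommon
    where
    divL : Carrier → Carrier → BinForm → Set
    divL u v s = Σ Carrier λ p → Σ Carrier λ q →
      s ≈F form (u * p) (u * q + v * p) (v * q)
    LinearCommon : Set
    LinearCommon = Σ Carrier λ u → Σ Carrier λ v →
      ¬ ((u ≈ 0#) × (v ≈ 0#)) × divL u v s₁ × divL u v s₂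
    divQ : BinForm → BinForm → Set
    divQ g s = Σ Carrier λ k → s ≈F form (k * cXX g) (k * cXY g) (k * cYY g)
    QuadraticCommon : Set
    QuadraticCommon = Σ BinForm λ g →
      ¬ ((cXX g ≈ 0#) × (cXY g ≈ 0#) × (cYY g ≈ 0#)) × divQ g s₁ × divQ g s₂

  NoCommonFactor : BinForm → BinForm → Set
  NoCommonFactor s₁ s₂ = ¬ CommonFactor s₁ s₂

  AtLeastPairs : ℕ → (BinForm → Set) → BinForm → BinForm → Set
  AtLeastPairs n P s₁ s₂ = Σ (Fin n → Carrier × Carrier) λ f →
    (∀ i j → proj₁ (f i) ≈ proj₁ (f j) →
             proj₂ (f i) ≈ proj₂ (f j) → i ≡ j) ×
    (∀ i → ¬ ((proj₁ (f i) ≈ 0#) × (proj₂ (f i) ≈ 0#))) ×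
    (∀ i → P (lincomb (proj₁ (f i)) s₁ (proj₂ (f i)) s₂))

mapForm : (K L : Field) → (Field.Carrier K → Field.Carrier L) → BinForm K → BinForm L
mapForm K L h s = form (h (cXX s)) (h (cXY s)) (h (cYY s))

-- r(s₁,s₂) = 2 : some a s₁ + b s₂ with (a,b) ∈ F̄² ∖ {0} has rank 2 over F̄.
-- F̄ is expressed through field extensions: there is an extension M of K
-- and (a,b) ∈ M² ∖ {0} such that a s₁ + b s₂ has rank 2 over every
-- extension L of M (equivalently, over an algebraic closure).
MaxRankIs2 : (K : Field) → BinForm K → BinForm K → Set₁
MaxRankIs2 K s₁ s₂ = Σ Field λ M → Σ (Extension K M) λ e →
  Σ (Field.Carrier M) λ a → Σ (Field.Carrier M) λ b →
  ¬ ((Field._≈_ M a (Field.0# M)) × (Field._≈_ M b (Field.0# M))) ×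
  ((L : Field) → (e′ : Extension M L) →
    HasRank L (mapForm M L (Extension.ι e′)
                 (lincomb M a (mapForm K M (Extension.ι e) s₁)
                            b (mapForm K M (Extension.ι e) s₂))) 2)

-- Up to nonzero scalars the members a s₁ + b s₂ of the pencil are indexed by the q + 1 points of
-- the projective line P¹(F).  As s₁ and s₂ have no common linear factor, every point of P¹(F) is a
-- zero of exactly one member, so the numbers of zeros of the members add up to q + 1.  A member of
-- nonzero discriminant is hyperbolic if it has a zero (and then it has exactly two) and anisotropic
-- otherwise; a degenerate member has at most one zero, and exactly one in odd characteristic.
-- Since r(s₁, s₂) = 2, in odd characteristic the discriminant of a s₁ + b s₂ is a nonzero binary
-- form in (a, b), so at most two members are degenerate; in characteristic 2 the degenerate members
-- are those whose XY-coefficient vanishes, and there is at most one.  Writing H, A, D for the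
-- numbers of hyperbolic, anisotropic and degenerate members, H + A + D = q + 1 and
-- 2H + D ≥ q + 1 ≥ 2H (with equality 2H + D = q + 1 in odd characteristic), whence 2H ≥ q − 1 and
-- 2A ≥ q − 1; every member contributes q − 1 pairs (a, b).

module Submission where

open import Level using (0ℓ)
open import Algebra.Bundles using (CommutativeRing)
open import Algebra.Morphism.Structures using (module RingMorphisms)
open import Data.Nat as ℕ using (ℕ; zero; suc; _∸_; _^_; _≤_; s≤s; z≤n)
import Data.Nat.Properties as ℕ
open import Data.Fin as Fin using (Fin; zero; suc; remQuot; combine)
import Data.Fin.Properties as Fin
open import Data.Product using (Σ; _×_; _,_; proj₁; proj₂; uncurry)
open import Data.Sum using (_⊎_; inj₁; inj₂)
open import Data.Empty using (⊥; ⊥-elim)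
open import Function using (_∘_; case_of_)
open import Relation.Nullary using (¬_; Dec; yes; no; ¬?; _×-dec_)
open import Relation.Nullary.Decidable using (decidable-stable)
open import Relation.Nullary.Decidable.Core using (¬¬-excluded-middle)
open import Relation.Unary using (Pred; Decidable)
open import Relation.Binary.PropositionalEquality as ≡ using (_≡_; _≢_)
open import Defs

-- The ring solver for an arbitrary commutative ring, with integer coefficients mapped along ℤ → R;
-- with coefficients in R itself, constants such as 1 − 1 would not be normalised.
module IntegerCoefficients (R : CommutativeRing 0ℓ 0ℓ) where
  open import Data.Integer as ℤ using (ℤ; +_; -[1+_]; _⊖_; sign; ∣_∣; _◃_)
  import Data.Integer.Properties as ℤ
  open import Data.Sign as Sign using (Sign)
  open import Data.Maybe using (Maybe; just; nothing)
  import Algebra.Solver.Ring.AlmostCommutativeRing as ACR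
  import Algebra.Properties.Semiring.Mult.TCOptimised as Mult
  import Algebra.Properties.Ring as RingProperties
  open CommutativeRing R
  open Mult semiring using (×-homo-+; ×1-homo-*) renaming (_×_ to _·_)
  open RingProperties ring using (-‿involutive; -‿distribˡ-*; -‿distribʳ-*; -0#≈0#; -‿+-comm)
  open import Relation.Binary.Reasoning.Setoid setoid

  fromℤ : ℤ → Carrier
  fromℤ (+ n)    = n · 1#
  fromℤ -[1+ n ] = - (suc n · 1#)

  fromℤ-neg : ∀ i → fromℤ (ℤ.- i) ≈ - fromℤ i
  fromℤ-neg -[1+ n ]    = sym (-‿involutive _)
  fromℤ-neg (+ zero)    = sym -0#≈0#
  fromℤ-neg (+ (suc n)) = refl

  fromℤ-⊖ : ∀ m n → fromℤ (m ⊖ n) ≈ m · 1# - n · 1#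
  fromℤ-⊖ zero zero = sym (trans (+-identityˡ _) -0#≈0#)
  fromℤ-⊖ (suc m) zero = sym (trans (+-congˡ -0#≈0#) (+-identityʳ _))
  fromℤ-⊖ zero (suc n) = sym (+-identityˡ _)
  fromℤ-⊖ (suc m) (suc n) = begin
    fromℤ (suc m ⊖ suc n)               ≡⟨ ≡.cong fromℤ (ℤ.[1+m]⊖[1+n]≡m⊖n m n) ⟩
    fromℤ (m ⊖ n)                       ≈⟨ fromℤ-⊖ m n ⟩
    m · 1# - n · 1#                     ≈⟨ sym (1+x-[1+y]≈x-y _ _) ⟩
    (1# + m · 1#) - (1# + n · 1#)       ≈⟨ +-cong (suc·1 m) (-‿cong (suc·1 n)) ⟩
    suc m · 1# - suc n · 1#             ∎
    where
    suc·1 : ∀ k → 1# + k · 1# ≈ suc k · 1#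
    suc·1 k = sym (×-homo-+ 1# 1 k)

    1+x-[1+y]≈x-y : ∀ x y → (1# + x) - (1# + y) ≈ x - y
    1+x-[1+y]≈x-y x y = begin
      (1# + x) + - (1# + y)     ≈⟨ +-congˡ (sym (-‿+-comm 1# y)) ⟩
      (1# + x) + (- 1# + - y)   ≈⟨ +-congʳ (+-comm 1# x) ⟩
      (x + 1#) + (- 1# + - y)   ≈⟨ +-assoc x 1# _ ⟩
      x + (1# + (- 1# + - y))   ≈⟨ +-congˡ (sym (+-assoc 1# (- 1#) (- y))) ⟩
      x + ((1# + - 1#) + - y)   ≈⟨ +-congˡ (+-congʳ (-‿inverseʳ 1#)) ⟩
      x + (0# + - y)            ≈⟨ +-congˡ (+-identityˡ (- y)) ⟩
      x - y                     ∎

  fromℤ-+ : ∀ i j → fromℤ (i ℤ.+ j) ≈ fromℤ i + fromℤ j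
  fromℤ-+ -[1+ m ] -[1+ n ] = begin
    - (suc (suc (m ℕ.+ n)) · 1#)        ≡⟨ ≡.cong (λ k → - (suc k · 1#)) (≡.sym (ℕ.+-suc m n)) ⟩
    - ((suc m ℕ.+ suc n) · 1#)          ≈⟨ -‿cong (×-homo-+ 1# (suc m) (suc n)) ⟩
    - (suc m · 1# + suc n · 1#)         ≈⟨ sym (-‿+-comm _ _) ⟩
    - (suc m · 1#) + - (suc n · 1#)     ∎
  fromℤ-+ -[1+ m ] (+ n) = trans (fromℤ-⊖ n (suc m)) (+-comm _ _)
  fromℤ-+ (+ m) -[1+ n ] = fromℤ-⊖ m (suc n)
  fromℤ-+ (+ m) (+ n)    = ×-homo-+ 1# m n

  fromℤ-* : ∀ i j → fromℤ (i ℤ.* j) ≈ fromℤ i * fromℤ j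
  fromℤ-* i j = begin
    fromℤ (sign i Sign.* sign j ◃ ∣ i ∣ ℕ.* ∣ j ∣)        ≈⟨ fromℤ-◃ (sign i Sign.* sign j) (∣ i ∣ ℕ.* ∣ j ∣) ⟩
    signed (sign i Sign.* sign j) ((∣ i ∣ ℕ.* ∣ j ∣) · 1#) ≈⟨ signed-cong (sign i Sign.* sign j) (×1-homo-* ∣ i ∣ ∣ j ∣) ⟩
    signed (sign i Sign.* sign j) (∣ i ∣ · 1# * ∣ j ∣ · 1#) ≈⟨ signed-* (sign i) (sign j) _ _ ⟩
    signed (sign i) (∣ i ∣ · 1#) * signed (sign j) (∣ j ∣ · 1#) ≈⟨ *-cong (fromℤ-signed i) (fromℤ-signed j) ⟩
    fromℤ i * fromℤ j                                          ∎
    where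
    signed : Sign → Carrier → Carrier
    signed Sign.+ x = x
    signed Sign.- x = - x

    signed-cong : ∀ s {x y} → x ≈ y → signed s x ≈ signed s y
    signed-cong Sign.+ x≈y = x≈y
    signed-cong Sign.- x≈y = -‿cong x≈y

    signed-* : ∀ s t x y → signed (s Sign.* t) (x * y) ≈ signed s x * signed t y
    signed-* Sign.+ Sign.+ x y = refl
    signed-* Sign.+ Sign.- x y = -‿distribʳ-* x y
    signed-* Sign.- Sign.+ x y = -‿distribˡ-* x y
    signed-* Sign.- Sign.- x y = begin
      x * y         ≈⟨ sym (-‿involutive (x * y)) ⟩
      - - (x * y)   ≈⟨ -‿cong (-‿distribˡ-* x y) ⟩
      - (- x * y)   ≈⟨ -‿distribʳ-* (- x) y ⟩
      - x * - y     ∎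

    fromℤ-◃ : ∀ s n → fromℤ (s ◃ n) ≈ signed s (n · 1#)
    fromℤ-◃ Sign.+ zero    = refl
    fromℤ-◃ Sign.- zero    = sym -0#≈0#
    fromℤ-◃ Sign.+ (suc n) = refl
    fromℤ-◃ Sign.- (suc n) = refl

    fromℤ-signed : ∀ k → signed (sign k) (∣ k ∣ · 1#) ≈ fromℤ k
    fromℤ-signed (+ n)    = refl
    fromℤ-signed -[1+ n ] = refl

  morphism : ACR._-Raw-AlmostCommutative⟶_ ℤ.+-*-rawRing (ACR.fromCommutativeRing R)
  morphism = record
    { ⟦_⟧    = fromℤ
    ; +-homo = fromℤ-+
    ; *-homo = fromℤ-*
    ; -‿homo = fromℤ-neg
    ; 0-homo = refl
    ; 1-homo = refl
    }

  weaklyDecidable : ∀ i j → Maybe (fromℤ i ≈ fromℤ j)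
  weaklyDecidable i j with i ℤ.≟ j
  ... | yes ≡.refl = just refl
  ... | no _       = nothing

  open import Algebra.Solver.Ring ℤ.+-*-rawRing (ACR.fromCommutativeRing R) morphism weaklyDecidable public

  :0 :1 : ∀ {n} → Polynomial n
  :0 = con (+ 0)
  :1 = con (+ 1)

module Counting where
  open import Data.Nat using (_+_; _*_)
  open import Relation.Binary.PropositionalEquality using (refl; sym; cong; cong₂)
  open import Algebra.Properties.CommutativeMonoid.Sum ℕ.+-0-commutativeMonoid public
    using (sum; ∑-distrib-+; ∑-comm)
  open import Algebra.Properties.Semiring.Sum ℕ.+-*-semiring using (*-distribˡ-sum)

  sum-mono-≤ : ∀ {n} {f g : Fin n → ℕ} → (∀ i → f i ≤ g i) → sum f ≤ sum g
  sum-mono-≤ {zero}  f≤g = z≤n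
  sum-mono-≤ {suc n} f≤g = ℕ.+-mono-≤ (f≤g zero) (sum-mono-≤ (f≤g ∘ suc))

  sum-cong : ∀ {n} {f g : Fin n → ℕ} → (∀ i → f i ≡ g i) → sum f ≡ sum g
  sum-cong {zero}  f≗g = refl
  sum-cong {suc n} f≗g = cong₂ _+_ (f≗g zero) (sum-cong (f≗g ∘ suc))

  sum-ones : ∀ n → sum {n} (λ _ → 1) ≡ n
  sum-ones zero    = refl
  sum-ones (suc n) = cong suc (sum-ones n)

  sum-*ˡ : ∀ {n} k (f : Fin n → ℕ) → sum (λ i → k * f i) ≡ k * sum f
  sum-*ˡ k f = sym (*-distribˡ-sum k f)

  indicator : ∀ {A : Set} → Dec A → ℕ
  indicator (yes _) = 1
  indicator (no _)  = 0

  count : ∀ {n} {P : Pred (Fin n) 0ℓ} → Decidable P → ℕ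
  count P? = sum (indicator ∘ P?)

  AtMostOne AtMostTwo : ∀ {n} → Pred (Fin n) 0ℓ → Set
  AtMostOne P = ∀ i j → P i → P j → i ≡ j
  AtMostTwo P = ∀ i j k → P i → P j → P k → i ≡ j ⊎ i ≡ k ⊎ j ≡ k

  module _ {n} {P : Pred (Fin (suc n)) 0ℓ} where
    private
      P′ : Pred (Fin n) 0ℓ
      P′ = P ∘ suc

    AtMostOne-suc : AtMostOne P → AtMostOne P′
    AtMostOne-suc atMost i j p q = Fin.suc-injective (atMost (suc i) (suc j) p q)

    AtMostTwo-suc : AtMostTwo P → AtMostTwo P′
    AtMostTwo-suc atMost i j k p q r with atMost (suc i) (suc j) (suc k) p q r
    ... | inj₁ e        = inj₁ (Fin.suc-injective e)
    ... | inj₂ (inj₁ e) = inj₂ (inj₁ (Fin.suc-injective e))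
    ... | inj₂ (inj₂ e) = inj₂ (inj₂ (Fin.suc-injective e))

    AtMostTwo-zero : AtMostTwo P → P zero → AtMostOne P′
    AtMostTwo-zero atMost p₀ i j p q with atMost zero (suc i) (suc j) p₀ p q
    ... | inj₂ (inj₂ e) = Fin.suc-injective e

  count-witness : ∀ {n} {P : Pred (Fin n) 0ℓ} (P? : Decidable P) → 1 ≤ count P? → Σ (Fin n) P
  count-witness {suc n} P? h with P? zero
  ... | yes p = zero , p
  ... | no _  with count-witness (P? ∘ suc) h
  ...   | i , p = suc i , p

  count≥1 : ∀ {n} {P : Pred (Fin n) 0ℓ} (P? : Decidable P) i → P i → 1 ≤ count P?
  count≥1 P? zero p with P? zero
  ... | yes _ = s≤s z≤n
  ... | no ¬p = ⊥-elim (¬p p)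
  count≥1 P? (suc i) p with P? zero
  ... | yes _ = s≤s z≤n
  ... | no _  = count≥1 (P? ∘ suc) i p

  count≥2 : ∀ {n} {P : Pred (Fin n) 0ℓ} (P? : Decidable P) i j → i ≢ j → P i → P j → 2 ≤ count P?
  count≥2 P? zero    zero    i≢j p q = ⊥-elim (i≢j refl)
  count≥2 P? zero    (suc j) i≢j p q with P? zero
  ... | yes _ = s≤s (count≥1 (P? ∘ suc) j q)
  ... | no ¬p = ⊥-elim (¬p p)
  count≥2 P? (suc i) zero    i≢j p q with P? zero
  ... | yes _ = s≤s (count≥1 (P? ∘ suc) i p)
  ... | no ¬q = ⊥-elim (¬q q)
  count≥2 P? (suc i) (suc j) i≢j p q with P? zero
  ... | yes _ = s≤s (count≥1 (P? ∘ suc) i p)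
  ... | no _  = count≥2 (P? ∘ suc) i j (i≢j ∘ cong suc) p q

  count≡0 : ∀ {n} {P : Pred (Fin n) 0ℓ} (P? : Decidable P) → (∀ i → ¬ P i) → count P? ≡ 0
  count≡0 {zero}  P? ¬P = refl
  count≡0 {suc n} P? ¬P with P? zero
  ... | yes p = ⊥-elim (¬P zero p)
  ... | no _  = count≡0 (P? ∘ suc) (¬P ∘ suc)

  count≤1 : ∀ {n} {P : Pred (Fin n) 0ℓ} (P? : Decidable P) → AtMostOne P → count P? ≤ 1
  count≤1 {zero}  P? atMost = z≤n
  count≤1 {suc n} P? atMost with P? zero
  ... | yes p = s≤s (ℕ.≤-reflexive (count≡0 (P? ∘ suc) λ i q → zero≢suc (atMost zero (suc i) p q)))
    where
    zero≢suc : ∀ {i : Fin n} → zero ≢ suc i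
    zero≢suc ()
  ... | no _  = count≤1 (P? ∘ suc) (AtMostOne-suc atMost)

  count≤2 : ∀ {n} {P : Pred (Fin n) 0ℓ} (P? : Decidable P) → AtMostTwo P → count P? ≤ 2
  count≤2 {zero}  P? atMost = z≤n
  count≤2 {suc n} P? atMost with P? zero
  ... | yes p = s≤s (count≤1 (P? ∘ suc) (AtMostTwo-zero atMost p))
  ... | no _  = count≤2 (P? ∘ suc) (AtMostTwo-suc atMost)

  count-¬ : ∀ {n} {P : Pred (Fin n) 0ℓ} (P? : Decidable P) → count P? + count (¬? ∘ P?) ≡ n
  count-¬ {n} P? = begin
    count P? + count (¬? ∘ P?)                      ≡⟨ sym (∑-distrib-+ (indicator ∘ P?) (indicator ∘ ¬? ∘ P?)) ⟩
    sum (λ i → indicator (P? i) + indicator (¬? (P? i))) ≡⟨ sum-cong (λ i → indicator-¬ (P? i)) ⟩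
    sum {n} (λ _ → 1)                               ≡⟨ sum-ones n ⟩
    n                                               ∎
    where
    open Relation.Binary.PropositionalEquality.≡-Reasoning
    indicator-¬ : ∀ {A : Set} (a : Dec A) → indicator a + indicator (¬? a) ≡ 1
    indicator-¬ (yes _) = refl
    indicator-¬ (no _)  = refl

  enumerate : ∀ {n} {P : Pred (Fin n) 0ℓ} (P? : Decidable P) → Fin (count P?) → Fin n
  enumerate {suc n} P? k with P? zero
  enumerate {suc n} P? zero    | yes _ = zero
  enumerate {suc n} P? (suc k) | yes _ = suc (enumerate (P? ∘ suc) k)
  enumerate {suc n} P? k       | no _  = suc (enumerate (P? ∘ suc) k)

  enumerate-sound : ∀ {n} {P : Pred (Fin n) 0ℓ} (P? : Decidable P) k → P (enumerate P? k)
  enumerate-sound {suc n} P? k with P? zero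
  enumerate-sound {suc n} P? zero    | yes p = p
  enumerate-sound {suc n} P? (suc k) | yes _ = enumerate-sound (P? ∘ suc) k
  enumerate-sound {suc n} P? k       | no _  = enumerate-sound (P? ∘ suc) k

  enumerate-injective : ∀ {n} {P : Pred (Fin n) 0ℓ} (P? : Decidable P) k l →
                        enumerate P? k ≡ enumerate P? l → k ≡ l
  enumerate-injective {suc n} P? k l e with P? zero
  enumerate-injective {suc n} P? zero    zero    e  | yes _ = refl
  enumerate-injective {suc n} P? (suc k) (suc l) e  | yes _ =
    cong suc (enumerate-injective (P? ∘ suc) k l (Fin.suc-injective e))
  enumerate-injective {suc n} P? k       l       e  | no _  =
    enumerate-injective (P? ∘ suc) k l (Fin.suc-injective e)

  indicator-partition : ∀ {A B : Set} (a : Dec A) (b : Dec B) →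
    indicator (¬? a ×-dec b) + indicator (¬? a ×-dec ¬? b) + indicator a ≡ 1
  indicator-partition (yes _) (yes _) = refl
  indicator-partition (yes _) (no _)  = refl
  indicator-partition (no _)  (yes _) = refl
  indicator-partition (no _)  (no _)  = refl

  ≤-indicators : ∀ {A : Set} z (a : Dec A) (b : Dec (1 ≤ z)) → (A → z ≤ 1) → z ≤ 2 →
    z ≤ 2 * indicator (¬? a ×-dec b) + indicator a
  ≤-indicators z       (yes p) _       z≤1 _   = z≤1 p
  ≤-indicators z       (no _)  (yes _) _   z≤2 = z≤2
  ≤-indicators zero    (no _)  (no _)  _   _   = z≤n
  ≤-indicators (suc z) (no _)  (no ¬b) _   _   = ⊥-elim (¬b (s≤s z≤n))

  indicators-≤ : ∀ {A : Set} z (a : Dec A) (b : Dec (1 ≤ z)) → (¬ A → 1 ≤ z → 2 ≤ z) →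
    2 * indicator (¬? a ×-dec b) ≤ z
  indicators-≤ z (yes _) _       _   = z≤n
  indicators-≤ z (no ¬a) (yes p) z≢1 = z≢1 ¬a p
  indicators-≤ z (no _)  (no _)  _   = z≤n

  indicators-≤′ : ∀ {A : Set} z (a : Dec A) (b : Dec (1 ≤ z)) → (¬ A → 1 ≤ z → 2 ≤ z) → (A → 1 ≤ z) →
    2 * indicator (¬? a ×-dec b) + indicator a ≤ z
  indicators-≤′ z (yes p) _       _   z≥1 = z≥1 p
  indicators-≤′ z (no ¬a) (yes p) z≢1 _   = ℕ.≤-trans (ℕ.≤-reflexive (ℕ.+-identityʳ 2)) (z≢1 ¬a p)
  indicators-≤′ z (no _)  (no _)  _   _   = z≤n

open Counting

module FieldFacts (K : Field) where
  open Field K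
  open IntegerCoefficients commRing using (solve; _:=_; _:+_; _:*_; _:-_; :-_; :0; :1)
  open import Relation.Binary.Reasoning.Setoid setoid

  inv : ∀ x → ¬ x ≈ 0# → Carrier
  inv x x≉0 = proj₁ (inverse x x≉0)

  x*inv≈1 : ∀ x (x≉0 : ¬ x ≈ 0#) → x * inv x x≉0 ≈ 1#
  x*inv≈1 x x≉0 = proj₂ (inverse x x≉0)

  x*y≈0⇒y≈0 : ∀ {x y} → ¬ x ≈ 0# → x * y ≈ 0# → y ≈ 0#
  x*y≈0⇒y≈0 {x} {y} x≉0 xy≈0 = begin
    y                ≈⟨ sym (*-identityˡ y) ⟩
    1# * y           ≈⟨ *-congʳ (sym (x*inv≈1 x x≉0)) ⟩
    (x * x⁻¹) * y    ≈⟨ solve 3 (λ x x⁻¹ y → (x :* x⁻¹) :* y := x⁻¹ :* (x :* y)) refl x x⁻¹ y ⟩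
    x⁻¹ * (x * y)    ≈⟨ *-congˡ xy≈0 ⟩
    x⁻¹ * 0#         ≈⟨ zeroʳ x⁻¹ ⟩
    0#               ∎
    where x⁻¹ = inv x x≉0

  *-≉0 : ∀ {x y} → ¬ x ≈ 0# → ¬ y ≈ 0# → ¬ x * y ≈ 0#
  *-≉0 x≉0 y≉0 xy≈0 = y≉0 (x*y≈0⇒y≈0 x≉0 xy≈0)

  inv≉0 : ∀ x (x≉0 : ¬ x ≈ 0#) → ¬ inv x x≉0 ≈ 0#
  inv≉0 x x≉0 inv≈0 = 0≉1 (begin
    0#              ≈⟨ sym (zeroʳ x) ⟩
    x * 0#          ≈⟨ *-congˡ (sym inv≈0) ⟩
    x * inv x x≉0   ≈⟨ x*inv≈1 x x≉0 ⟩
    1#              ∎)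

  x*x≈0⇒¬¬x≈0 : ∀ x → x * x ≈ 0# → ¬ ¬ x ≈ 0#
  x*x≈0⇒¬¬x≈0 x xx≈0 x≉0 = *-≉0 x≉0 x≉0 xx≈0

  x-y≈0⇒x≈y : ∀ {x y} → x - y ≈ 0# → x ≈ y
  x-y≈0⇒x≈y {x} {y} x-y≈0 = begin
    x              ≈⟨ solve 2 (λ x y → x := (x :- y) :+ y) refl x y ⟩
    (x - y) + y    ≈⟨ +-congʳ x-y≈0 ⟩
    0# + y         ≈⟨ +-identityˡ y ⟩
    y              ∎

  -1≉0 : ¬ - 1# ≈ 0#
  -1≉0 -1≈0 = 0≉1 (sym (begin
    1#        ≈⟨ solve 0 (:1 := :- (:- :1)) refl ⟩
    - - 1#    ≈⟨ -‿cong -1≈0 ⟩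
    - 0#      ≈⟨ solve 0 (:- :0 := :0) refl ⟩
    0#        ∎))

  two : Carrier
  two = 1# + 1#

  det : Carrier → Carrier → Carrier → Carrier → Carrier
  det α β γ δ = α * δ - β * γ

  det≉0⇒trivial-solution : ∀ {a b a′ b′ x y} → ¬ det a a′ b b′ ≈ 0# →
    a * x + b * y ≈ 0# → a′ * x + b′ * y ≈ 0# → (x ≈ 0#) × (y ≈ 0#)
  det≉0⇒trivial-solution {a} {b} {a′} {b′} {x} {y} d≉0 e e′ =
      x*y≈0⇒y≈0 d≉0 (begin
        det a a′ b b′ * x                                 ≈⟨ solve 6 (λ a b a′ b′ x y →
          (a :* b′ :- a′ :* b) :* x := b′ :* (a :* x :+ b :* y) :- b :* (a′ :* x :+ b′ :* y)) refl a b a′ b′ x y ⟩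
        b′ * (a * x + b * y) - b * (a′ * x + b′ * y)      ≈⟨ +-cong (*-congˡ e) (-‿cong (*-congˡ e′)) ⟩
        b′ * 0# - b * 0#                                  ≈⟨ solve 2 (λ b b′ → b′ :* :0 :- b :* :0 := :0) refl b b′ ⟩
        0#                                                ∎)
    , x*y≈0⇒y≈0 d≉0 (begin
        det a a′ b b′ * y                                 ≈⟨ solve 6 (λ a b a′ b′ x y →
          (a :* b′ :- a′ :* b) :* y := a :* (a′ :* x :+ b′ :* y) :- a′ :* (a :* x :+ b :* y)) refl a b a′ b′ x y ⟩
        a * (a′ * x + b′ * y) - a′ * (a * x + b * y)      ≈⟨ +-cong (*-congˡ e′) (-‿cong (*-congˡ e)) ⟩
        a * 0# - a′ * 0#                                  ≈⟨ solve 2 (λ a a′ → a :* :0 :- a′ :* :0 := :0) refl a a′ ⟩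
        0#                                                ∎)

  det≉0⇒column≉0 : ∀ {x₁ x₂ y₁ y₂} → ¬ det x₁ x₂ y₁ y₂ ≈ 0# → ¬ ((x₂ ≈ 0#) × (y₂ ≈ 0#))
  det≉0⇒column≉0 {x₁} {x₂} {y₁} {y₂} d≉0 (x₂≈0 , y₂≈0) = d≉0 (begin
    x₁ * y₂ - x₂ * y₁     ≈⟨ +-cong (*-congˡ y₂≈0) (-‿cong (*-congʳ x₂≈0)) ⟩
    x₁ * 0# - 0# * y₁     ≈⟨ solve 2 (λ x₁ y₁ → x₁ :* :0 :- :0 :* y₁ := :0) refl x₁ y₁ ⟩
    0#                    ∎)

  idExtension : Extension K K
  idExtension = record
    { ι     = λ x → x
    ; isHom = record
      { isSemiringHomomorphism = record
        { isNearSemiringHomomorphism = record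
          { +-isMonoidHomomorphism = record
            { isMagmaHomomorphism = record
              { isRelHomomorphism = record { cong = λ x≈y → x≈y }
              ; homo = λ _ _ → refl }
            ; ε-homo = refl }
          ; *-homo = λ _ _ → refl }
        ; 1#-homo = refl }
      ; -‿homo = λ _ → refl }
    }

module BinaryForms (K : Field) where
  open Field K
  open FieldFacts K
  open IntegerCoefficients commRing using (solve; _:=_; _:+_; _:*_; _:-_; :-_; :0; :1)
  open import Relation.Binary.Reasoning.Setoid setoid

  disc : BinForm K → Carrier
  disc s = cXY s * cXY s - (cXX s * cYY s + cXX s * cYY s + cXX s * cYY s + cXX s * cYY s)

  disc-cong : ∀ {s t} → _≈F_ K s t → disc s ≈ disc t
  disc-cong {s} {t} (a≈ , b≈ , c≈) = +-cong (*-cong b≈ b≈) (-‿cong (+-cong (+-cong (+-cong ac≈ ac≈) ac≈) ac≈))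
    where
    ac≈ : cXX s * cYY s ≈ cXX t * cYY t
    ac≈ = *-cong a≈ c≈

  disc-subst : ∀ α β γ δ s → disc (subst K α β γ δ s) ≈ (det α β γ δ * det α β γ δ) * disc s
  disc-subst α β γ δ s = solve 7 (λ a b c α β γ δ →
    let D = λ a b c → b :* b :- (a :* c :+ a :* c :+ a :* c :+ a :* c) in
    D (a :* α :* α :+ b :* α :* γ :+ c :* γ :* γ)
      ((a :* α :* β :+ a :* α :* β) :+ b :* (α :* δ :+ β :* γ) :+ (c :* γ :* δ :+ c :* γ :* δ))
      (a :* β :* β :+ b :* β :* δ :+ c :* δ :* δ)
    := ((α :* δ :- β :* γ) :* (α :* δ :- β :* γ)) :* D a b c) refl (cXX s) (cXY s) (cYY s) α β γ δ

  discMixed : BinForm K → BinForm K → Carrier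
  discMixed s t = (cXY s * cXY t + cXY s * cXY t) - (m + m + m + m)
    where m = cXX s * cYY t + cXX t * cYY s

  discForm : BinForm K → BinForm K → BinForm K
  discForm s t = form (disc s) (discMixed s t) (disc t)

  disc-lincomb : ∀ a b s t → disc (lincomb K a s b t) ≈ eval K (discForm s t) a b
  disc-lincomb a b s t = solve 8 (λ a b a₁ b₁ c₁ a₂ b₂ c₂ →
    let D = λ a b c → b :* b :- (a :* c :+ a :* c :+ a :* c :+ a :* c)
        m = a₁ :* c₂ :+ a₂ :* c₁ in
    D (a :* a₁ :+ b :* a₂) (a :* b₁ :+ b :* b₂) (a :* c₁ :+ b :* c₂)
    := D a₁ b₁ c₁ :* a :* a :+ ((b₁ :* b₂ :+ b₁ :* b₂) :- (m :+ m :+ m :+ m)) :* a :* b :+ D a₂ b₂ c₂ :* b :* b)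
    refl a b (cXX s) (cXY s) (cYY s) (cXX t) (cXY t) (cYY t)

  disc-lincomb-scale : ∀ l a b s t →
    disc (lincomb K (l * a) s (l * b) t) ≈ (l * l) * disc (lincomb K a s b t)
  disc-lincomb-scale l a b s t = solve 9 (λ l a b a₁ b₁ c₁ a₂ b₂ c₂ →
    let D = λ a b c → b :* b :- (a :* c :+ a :* c :+ a :* c :+ a :* c) in
    D ((l :* a) :* a₁ :+ (l :* b) :* a₂) ((l :* a) :* b₁ :+ (l :* b) :* b₂) ((l :* a) :* c₁ :+ (l :* b) :* c₂)
    := (l :* l) :* D (a :* a₁ :+ b :* a₂) (a :* b₁ :+ b :* b₂) (a :* c₁ :+ b :* c₂))
    refl l a b (cXX s) (cXY s) (cYY s) (cXX t) (cXY t) (cYY t)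

  eval-cong : ∀ s {x x′ y y′} → x ≈ x′ → y ≈ y′ → eval K s x y ≈ eval K s x′ y′
  eval-cong s x≈ y≈ = +-cong (+-cong (*-cong (*-congˡ x≈) x≈) (*-cong (*-congˡ x≈) y≈)) (*-cong (*-congˡ y≈) y≈)

  eval-homogeneous : ∀ s l x y → eval K s (l * x) (l * y) ≈ (l * l) * eval K s x y
  eval-homogeneous s l x y = solve 6 (λ a b c l x y →
    a :* (l :* x) :* (l :* x) :+ b :* (l :* x) :* (l :* y) :+ c :* (l :* y) :* (l :* y)
    := (l :* l) :* (a :* x :* x :+ b :* x :* y :+ c :* y :* y)) refl (cXX s) (cXY s) (cYY s) l x y

  eval-lincomb : ∀ a b s t x y → eval K (lincomb K a s b t) x y ≈ a * eval K s x y + b * eval K t x y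
  eval-lincomb a b s t x y = solve 10 (λ a b a₁ b₁ c₁ a₂ b₂ c₂ x y →
    let E = λ A B C → A :* x :* x :+ B :* x :* y :+ C :* y :* y in
    E (a :* a₁ :+ b :* a₂) (a :* b₁ :+ b :* b₂) (a :* c₁ :+ b :* c₂) := a :* E a₁ b₁ c₁ :+ b :* E a₂ b₂ c₂)
    refl a b (cXX s) (cXY s) (cYY s) (cXX t) (cXY t) (cYY t) x y

  eval-lincomb-scale : ∀ l a b s t x y →
    eval K (lincomb K (l * a) s (l * b) t) x y ≈ l * eval K (lincomb K a s b t) x y
  eval-lincomb-scale l a b s t x y = solve 11 (λ l a b a₁ b₁ c₁ a₂ b₂ c₂ x y →
    let E = λ A B C → A :* x :* x :+ B :* x :* y :+ C :* y :* y in
    E ((l :* a) :* a₁ :+ (l :* b) :* a₂) ((l :* a) :* b₁ :+ (l :* b) :* b₂) ((l :* a) :* c₁ :+ (l :* b) :* c₂)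
    := l :* E (a :* a₁ :+ b :* a₂) (a :* b₁ :+ b :* b₂) (a :* c₁ :+ b :* c₂))
    refl l a b (cXX s) (cXY s) (cYY s) (cXX t) (cXY t) (cYY t) x y

  rank≤1⇒disc≈0 : ∀ s → RankAtMost K s 1 → disc s ≈ 0#
  rank≤1⇒disc≈0 s (α , β , γ , δ , T-inv , b′≈0 , c′≈0) = x*y≈0⇒y≈0 (*-≉0 T-inv T-inv) (begin
    (det α β γ δ * det α β γ δ) * disc s   ≈⟨ sym (disc-subst α β γ δ s) ⟩
    disc s′                                 ≈⟨ disc-cong {s′} {form (cXX s′) 0# 0#} (refl , b′≈0 , c′≈0) ⟩
    0# * 0# - (a′ * 0# + a′ * 0# + a′ * 0# + a′ * 0#) ≈⟨ solve 1 (λ a′ → :0 :* :0 :- (a′ :* :0 :+ a′ :* :0 :+ a′ :* :0 :+ a′ :* :0) := :0) refl a′ ⟩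
    0#                                      ∎)
    where
    s′ = subst K α β γ δ s
    a′ = cXX s′

  disc≉0⇒rank2 : ∀ s → ¬ disc s ≈ 0# → HasRank K s 2
  disc≉0⇒rank2 s d≉0 = _ , λ where
    zero          _                 (α , β , γ , δ , T-inv , _ , b′≈0 , c′≈0) →
      d≉0 (rank≤1⇒disc≈0 s (α , β , γ , δ , T-inv , b′≈0 , c′≈0))
    (suc zero)    _                 rank≤1 → d≉0 (rank≤1⇒disc≈0 s rank≤1)
    (suc (suc _)) (s≤s (s≤s ()))

  -- s(β, δ) is the YY-coefficient of subst α β γ δ s, which vanishes when the rank is at most one.
  rank≤1⇒isotropic : ∀ s → RankAtMost K s 1 →
    Σ Carrier λ x → Σ Carrier λ y → ¬ ((x ≈ 0#) × (y ≈ 0#)) × (eval K s x y ≈ 0#)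
  rank≤1⇒isotropic s (α , β , γ , δ , T-inv , _ , c′≈0) = β , δ , βδ≉0 , c′≈0
    where
    βδ≉0 : ¬ ((β ≈ 0#) × (δ ≈ 0#))
    βδ≉0 (β≈0 , δ≈0) = T-inv (begin
      α * δ - β * γ   ≈⟨ +-cong (*-congˡ δ≈0) (-‿cong (*-congʳ β≈0)) ⟩
      α * 0# - 0# * γ ≈⟨ solve 2 (λ α γ → α :* :0 :- :0 :* γ := :0) refl α γ ⟩
      0#              ∎)

  a≈0∧b≈0⇒rank≤1 : ∀ s → cXX s ≈ 0# → cXY s ≈ 0# → RankAtMost K s 1
  a≈0∧b≈0⇒rank≤1 s a≈0 b≈0 = 0# , 1# , 1# , 0# , swap-inv , b′≈0 , c′≈0
    where
    a = cXX s ; b = cXY s ; c = cYY s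
    swap-inv : ¬ det 0# 1# 1# 0# ≈ 0#
    swap-inv d≈0 = -1≉0 (trans (solve 0 (:- :1 := :0 :* :0 :- :1 :* :1) refl) d≈0)
    b′≈0 : (a * 0# * 1# + a * 0# * 1#) + b * (0# * 0# + 1# * 1#) + (c * 1# * 0# + c * 1# * 0#) ≈ 0#
    b′≈0 = trans (solve 3 (λ a b c → (a :* :0 :* :1 :+ a :* :0 :* :1) :+ b :* (:0 :* :0 :+ :1 :* :1)
                                     :+ (c :* :1 :* :0 :+ c :* :1 :* :0) := b) refl a b c) b≈0
    c′≈0 : a * 1# * 1# + b * 1# * 0# + c * 0# * 0# ≈ 0#
    c′≈0 = trans (solve 3 (λ a b c → a :* :1 :* :1 :+ b :* :1 :* :0 :+ c :* :0 :* :0 := a) refl a b c) a≈0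

  -- The shear X ↦ X + tY turns s into a X² + (2at + b) XY + s(t, 1) Y².
  shear-rank≤1 : ∀ s t → cXX s * t + cXX s * t + cXY s ≈ 0# →
    cXX s * (t * t) + cXY s * t + cYY s ≈ 0# → RankAtMost K s 1
  shear-rank≤1 s t b′≈0 c′≈0 = 1# , t , 0# , 1# , shear-inv ,
      trans (solve 4 (λ a b c t → (a :* :1 :* t :+ a :* :1 :* t) :+ b :* (:1 :* :1 :+ t :* :0)
                                  :+ (c :* :0 :* :1 :+ c :* :0 :* :1) := a :* t :+ a :* t :+ b) refl a b c t) b′≈0 ,
      trans (solve 4 (λ a b c t → a :* t :* t :+ b :* t :* :1 :+ c :* :1 :* :1
                                  := a :* (t :* t) :+ b :* t :+ c) refl a b c t) c′≈0
    where
    a = cXX s ; b = cXY s ; c = cYY s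
    shear-inv : ¬ det 1# t 0# 1# ≈ 0#
    shear-inv d≈0 = 0≉1 (sym (trans (solve 1 (λ t → :1 := :1 :* :1 :- t :* :0) refl t) d≈0))

  -- Completing the square: 4a · s(t, 1) = (2at + b)² − disc s, so t = −b/2a works.
  completing-square : ¬ two ≈ 0# → ∀ s → ¬ cXX s ≈ 0# → disc s ≈ 0# → RankAtMost K s 1
  completing-square two≉0 s a≉0 d≈0 = shear-rank≤1 s t 2at+b≈0 (x*y≈0⇒y≈0 4a≉0 (begin
      (2a + 2a) * (a * (t * t) + b * t + c)    ≈⟨ solve 4 (λ a b c t →
        ((a :+ a) :+ (a :+ a)) :* (a :* (t :* t) :+ b :* t :+ c)
        := (a :* t :+ a :* t :+ b) :* (a :* t :+ a :* t :+ b) :- (b :* b :- (a :* c :+ a :* c :+ a :* c :+ a :* c))) refl a b c t ⟩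
      (a * t + a * t + b) * (a * t + a * t + b) - disc s   ≈⟨ +-cong (*-cong 2at+b≈0 2at+b≈0) (-‿cong d≈0) ⟩
      0# * 0# - 0#                              ≈⟨ solve 0 (:0 :* :0 :- :0 := :0) refl ⟩
      0#                                        ∎))
    where
    a = cXX s ; b = cXY s ; c = cYY s
    2a = a + a

    double≉0 : ∀ {x} → ¬ x ≈ 0# → ¬ x + x ≈ 0#
    double≉0 {x} x≉0 2x≈0 = *-≉0 two≉0 x≉0 (trans (solve 1 (λ x → (:1 :+ :1) :* x := x :+ x) refl x) 2x≈0)

    2a≉0 : ¬ 2a ≈ 0#
    2a≉0 = double≉0 a≉0

    4a≉0 : ¬ 2a + 2a ≈ 0#
    4a≉0 = double≉0 2a≉0

    t : Carrier
    t = - (b * inv 2a 2a≉0)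

    2at+b≈0 : a * t + a * t + b ≈ 0#
    2at+b≈0 = begin
      a * t + a * t + b                 ≈⟨ solve 3 (λ a b w → a :* (:- (b :* w)) :+ a :* (:- (b :* w)) :+ b := b :- ((a :+ a) :* w) :* b) refl a b (inv 2a 2a≉0) ⟩
      b - (2a * inv 2a 2a≉0) * b        ≈⟨ +-congˡ (-‿cong (*-congʳ (x*inv≈1 2a 2a≉0))) ⟩
      b - 1# * b                        ≈⟨ solve 1 (λ b → b :- :1 :* b := :0) refl b ⟩
      0#                                ∎

  disc≈0⇒¬¬rank≤1 : ¬ two ≈ 0# → ∀ s → disc s ≈ 0# → ¬ ¬ RankAtMost K s 1
  disc≈0⇒¬¬rank≤1 two≉0 s d≈0 ¬rank≤1 = ¬¬-excluded-middle λ where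
      (yes a≈0) → x*x≈0⇒¬¬x≈0 b (b²≈0 a≈0) (λ b≈0 → ¬rank≤1 (a≈0∧b≈0⇒rank≤1 s a≈0 b≈0))
      (no a≉0)  → ¬rank≤1 (completing-square two≉0 s a≉0 d≈0)
    where
    a = cXX s ; b = cXY s ; c = cYY s

    b²≈0 : a ≈ 0# → b * b ≈ 0#
    b²≈0 a≈0 = begin
      b * b                                 ≈⟨ solve 3 (λ a b c → b :* b := (b :* b :- (a :* c :+ a :* c :+ a :* c :+ a :* c)) :+ (a :+ a :+ a :+ a) :* c) refl a b c ⟩
      disc s + (a + a + a + a) * c          ≈⟨ +-cong d≈0 (*-congʳ (+-cong (+-cong (+-cong a≈0 a≈0) a≈0) a≈0)) ⟩
      0# + (0# + 0# + 0# + 0#) * c          ≈⟨ solve 1 (λ c → :0 :+ (:0 :+ :0 :+ :0 :+ :0) :* c := :0) refl c ⟩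
      0#                                    ∎

  IsZero : BinForm K → Set
  IsZero s = _≈F_ K s (form 0# 0# 0#)

  vanishing⇒zero : ∀ s → (∀ x y → eval K s x y ≈ 0#) → IsZero s
  vanishing⇒zero s s≈0 =
      trans (solve 3 (λ a b c → a := a :* :1 :* :1 :+ b :* :1 :* :0 :+ c :* :0 :* :0) refl a b c) (s≈0 1# 0#)
    , (begin
      b                                              ≈⟨ solve 3 (λ a b c → b := (a :* :1 :* :1 :+ b :* :1 :* :1 :+ c :* :1 :* :1)
        :- (a :* :1 :* :1 :+ b :* :1 :* :0 :+ c :* :0 :* :0) :- (a :* :0 :* :0 :+ b :* :0 :* :1 :+ c :* :1 :* :1)) refl a b c ⟩
      eval K s 1# 1# - eval K s 1# 0# - eval K s 0# 1#  ≈⟨ +-cong (+-cong (s≈0 1# 1#) (-‿cong (s≈0 1# 0#))) (-‿cong (s≈0 0# 1#)) ⟩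
      0# - 0# - 0#                                   ≈⟨ solve 0 (:0 :- :0 :- :0 := :0) refl ⟩
      0#                                             ∎)
    , trans (solve 3 (λ a b c → c := a :* :0 :* :0 :+ b :* :0 :* :1 :+ c :* :1 :* :1) refl a b c) (s≈0 0# 1#)
    where a = cXX s ; b = cXY s ; c = cYY s

  -- Lagrange interpolation: det₁₂ det₁₃ det₂₃ · s is a combination of s(P₁), s(P₂), s(P₃).
  three-independent-roots⇒zero : ∀ s x₁ y₁ x₂ y₂ x₃ y₃ →
    ¬ det x₁ x₂ y₁ y₂ ≈ 0# → ¬ det x₁ x₃ y₁ y₃ ≈ 0# → ¬ det x₂ x₃ y₂ y₃ ≈ 0# →
    eval K s x₁ y₁ ≈ 0# → eval K s x₂ y₂ ≈ 0# → eval K s x₃ y₃ ≈ 0# → IsZero s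
  three-independent-roots⇒zero s x₁ y₁ x₂ y₂ x₃ y₃ d₁₂≉0 d₁₃≉0 d₂₃≉0 r₁ r₂ r₃ =
    vanishing⇒zero s λ X Y → x*y≈0⇒y≈0 (*-≉0 (*-≉0 d₁₂≉0 d₁₃≉0) d₂₃≉0) (begin
      (d x₁ y₁ x₂ y₂ * d x₁ y₁ x₃ y₃ * d x₂ y₂ x₃ y₃) * eval K s X Y
        ≈⟨ lagrange (cXX s) (cXY s) (cYY s) x₁ y₁ x₂ y₂ x₃ y₃ X Y ⟩
      eval K s x₁ y₁ * d x₂ y₂ x₃ y₃ * (d x₂ y₂ X Y * d x₃ y₃ X Y)
        - eval K s x₂ y₂ * d x₁ y₁ x₃ y₃ * (d x₁ y₁ X Y * d x₃ y₃ X Y)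
        + eval K s x₃ y₃ * d x₁ y₁ x₂ y₂ * (d x₁ y₁ X Y * d x₂ y₂ X Y)
        ≈⟨ +-cong (+-cong (*-congʳ (*-congʳ r₁)) (-‿cong (*-congʳ (*-congʳ r₂)))) (*-congʳ (*-congʳ r₃)) ⟩
      0# * d x₂ y₂ x₃ y₃ * (d x₂ y₂ X Y * d x₃ y₃ X Y)
        - 0# * d x₁ y₁ x₃ y₃ * (d x₁ y₁ X Y * d x₃ y₃ X Y)
        + 0# * d x₁ y₁ x₂ y₂ * (d x₁ y₁ X Y * d x₂ y₂ X Y)
        ≈⟨ solve 6 (λ u v w u′ v′ w′ → :0 :* u :* u′ :- :0 :* v :* v′ :+ :0 :* w :* w′ := :0) refl _ _ _ _ _ _ ⟩
      0# ∎)
    where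
    d : Carrier → Carrier → Carrier → Carrier → Carrier
    d x y x′ y′ = det x x′ y y′

    lagrange : ∀ a b c x₁ y₁ x₂ y₂ x₃ y₃ X Y →
      let t = λ x y → a * x * x + b * x * y + c * y * y in
      (d x₁ y₁ x₂ y₂ * d x₁ y₁ x₃ y₃ * d x₂ y₂ x₃ y₃) * t X Y
      ≈ t x₁ y₁ * d x₂ y₂ x₃ y₃ * (d x₂ y₂ X Y * d x₃ y₃ X Y)
        - t x₂ y₂ * d x₁ y₁ x₃ y₃ * (d x₁ y₁ X Y * d x₃ y₃ X Y)
        + t x₃ y₃ * d x₁ y₁ x₂ y₂ * (d x₁ y₁ X Y * d x₂ y₂ X Y)
    lagrange = solve 11 (λ a b c x₁ y₁ x₂ y₂ x₃ y₃ X Y →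
      let t = λ x y → a :* x :* x :+ b :* x :* y :+ c :* y :* y
          d = λ x y x′ y′ → x :* y′ :- x′ :* y in
      (d x₁ y₁ x₂ y₂ :* d x₁ y₁ x₃ y₃ :* d x₂ y₂ x₃ y₃) :* t X Y
      := t x₁ y₁ :* d x₂ y₂ x₃ y₃ :* (d x₂ y₂ X Y :* d x₃ y₃ X Y)
        :- t x₂ y₂ :* d x₁ y₁ x₃ y₃ :* (d x₁ y₁ X Y :* d x₃ y₃ X Y)
        :+ t x₃ y₃ :* d x₁ y₁ x₂ y₂ :* (d x₁ y₁ X Y :* d x₂ y₂ X Y)) refl

  -- The polar form B(P, Q) = s(P + Q) − s(P) − s(Q), i.e. the XY-coefficient of s ∘ (P Q).
  polar : BinForm K → Carrier → Carrier → Carrier → Carrier → Carrier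
  polar s x₁ y₁ x₂ y₂ = cXY (subst K x₁ x₂ y₁ y₂ s)

  eval-+ : ∀ s x₁ y₁ x₂ y₂ →
    eval K s (x₁ + x₂) (y₁ + y₂) ≈ eval K s x₁ y₁ + polar s x₁ y₁ x₂ y₂ + eval K s x₂ y₂
  eval-+ s x₁ y₁ x₂ y₂ = solve 7 (λ a b c x₁ y₁ x₂ y₂ →
    a :* (x₁ :+ x₂) :* (x₁ :+ x₂) :+ b :* (x₁ :+ x₂) :* (y₁ :+ y₂) :+ c :* (y₁ :+ y₂) :* (y₁ :+ y₂)
    := (a :* x₁ :* x₁ :+ b :* x₁ :* y₁ :+ c :* y₁ :* y₁)
       :+ ((a :* x₁ :* x₂ :+ a :* x₁ :* x₂) :+ b :* (x₁ :* y₂ :+ x₂ :* y₁) :+ (c :* y₁ :* y₂ :+ c :* y₁ :* y₂))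
       :+ (a :* x₂ :* x₂ :+ b :* x₂ :* y₂ :+ c :* y₂ :* y₂)) refl (cXX s) (cXY s) (cYY s) x₁ y₁ x₂ y₂

  polar²≈det²·disc : ∀ s x₁ y₁ x₂ y₂ → eval K s x₁ y₁ ≈ 0# →
    polar s x₁ y₁ x₂ y₂ * polar s x₁ y₁ x₂ y₂ ≈ (det x₁ x₂ y₁ y₂ * det x₁ x₂ y₁ y₂) * disc s
  polar²≈det²·disc s x₁ y₁ x₂ y₂ r₁ = begin
    B * B                                          ≈⟨ solve 2 (λ B c′ → B :* B := B :* B :- (:0 :* c′ :+ :0 :* c′ :+ :0 :* c′ :+ :0 :* c′)) refl B c′ ⟩
    disc (form 0# B c′)                            ≈⟨ disc-cong {form 0# B c′} {s′} (sym r₁ , refl , refl) ⟩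
    disc s′                                        ≈⟨ disc-subst x₁ x₂ y₁ y₂ s ⟩
    (det x₁ x₂ y₁ y₂ * det x₁ x₂ y₁ y₂) * disc s   ∎
    where
    s′ = subst K x₁ x₂ y₁ y₂ s
    B = cXY s′ ; c′ = cYY s′

  polar≉0 : ∀ s x₁ y₁ x₂ y₂ → ¬ disc s ≈ 0# → ¬ det x₁ x₂ y₁ y₂ ≈ 0# → eval K s x₁ y₁ ≈ 0# →
    ¬ polar s x₁ y₁ x₂ y₂ ≈ 0#
  polar≉0 s x₁ y₁ x₂ y₂ d≉0 T-inv r₁ B≈0 = *-≉0 (*-≉0 T-inv T-inv) d≉0 (begin
    (det x₁ x₂ y₁ y₂ * det x₁ x₂ y₁ y₂) * disc s   ≈⟨ sym (polar²≈det²·disc s x₁ y₁ x₂ y₂ r₁) ⟩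
    B * B                                          ≈⟨ *-congʳ B≈0 ⟩
    0# * B                                         ≈⟨ zeroˡ B ⟩
    0#                                             ∎)
    where B = polar s x₁ y₁ x₂ y₂

  -- If B(P, Q) ≈ 0 then P + Q is a third root.
  polar≈0⇒zero : ∀ s x₁ y₁ x₂ y₂ → ¬ det x₁ x₂ y₁ y₂ ≈ 0# →
    eval K s x₁ y₁ ≈ 0# → eval K s x₂ y₂ ≈ 0# → polar s x₁ y₁ x₂ y₂ ≈ 0# → IsZero s
  polar≈0⇒zero s x₁ y₁ x₂ y₂ d≉0 r₁ r₂ B≈0 = three-independent-roots⇒zero s x₁ y₁ x₂ y₂ (x₁ + x₂) (y₁ + y₂)
    d≉0 (λ d≈0 → d≉0 (trans (solve 4 (λ x₁ y₁ x₂ y₂ → x₁ :* y₂ :- x₂ :* y₁ := x₁ :* (y₁ :+ y₂) :- (x₁ :+ x₂) :* y₁) refl x₁ y₁ x₂ y₂) d≈0))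
        (λ d≈0 → d≉0 (trans (solve 4 (λ x₁ y₁ x₂ y₂ → x₁ :* y₂ :- x₂ :* y₁ := :- (x₂ :* (y₁ :+ y₂) :- (x₁ :+ x₂) :* y₂)) refl x₁ y₁ x₂ y₂)
                              (trans (-‿cong d≈0) (solve 0 (:- :0 := :0) refl))))
    r₁ r₂ (begin
      eval K s (x₁ + x₂) (y₁ + y₂)                            ≈⟨ eval-+ s x₁ y₁ x₂ y₂ ⟩
      eval K s x₁ y₁ + polar s x₁ y₁ x₂ y₂ + eval K s x₂ y₂   ≈⟨ +-cong (+-cong r₁ B≈0) r₂ ⟩
      0# + 0# + 0#                                            ≈⟨ solve 0 (:0 :+ :0 :+ :0 := :0) refl ⟩
      0#                                                      ∎)

  -- s(kQ − cP) = c² s(P), and det(P, kQ − cP) = k det(P, Q) with k ≉ 0 because disc s ≉ 0.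
  second-root : ∀ s x₁ y₁ x₂ y₂ → ¬ disc s ≈ 0# → ¬ det x₁ x₂ y₁ y₂ ≈ 0# → eval K s x₁ y₁ ≈ 0# →
    let k = polar s x₁ y₁ x₂ y₂ ; c = eval K s x₂ y₂ in
    (eval K s (k * x₂ - c * x₁) (k * y₂ - c * y₁) ≈ 0#) × ¬ det x₁ (k * x₂ - c * x₁) y₁ (k * y₂ - c * y₁) ≈ 0#
  second-root s x₁ y₁ x₂ y₂ d≉0 T-inv r₁ =
    (begin
      eval K s (k * x₂ - c * x₁) (k * y₂ - c * y₁)  ≈⟨ solve 7 (λ a b c x₁ y₁ x₂ y₂ →
        let t = λ x y → a :* x :* x :+ b :* x :* y :+ c :* y :* y
            k = (a :* x₁ :* x₂ :+ a :* x₁ :* x₂) :+ b :* (x₁ :* y₂ :+ x₂ :* y₁) :+ (c :* y₁ :* y₂ :+ c :* y₁ :* y₂) in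
        t (k :* x₂ :- t x₂ y₂ :* x₁) (k :* y₂ :- t x₂ y₂ :* y₁) := (t x₂ y₂ :* t x₂ y₂) :* t x₁ y₁)
        refl (cXX s) (cXY s) (cYY s) x₁ y₁ x₂ y₂ ⟩
      (c * c) * eval K s x₁ y₁                      ≈⟨ *-congˡ r₁ ⟩
      (c * c) * 0#                                  ≈⟨ zeroʳ _ ⟩
      0#                                            ∎)
    , λ d≈0 → *-≉0 (polar≉0 s x₁ y₁ x₂ y₂ d≉0 T-inv r₁) T-inv (trans
        (solve 6 (λ k c x₁ y₁ x₂ y₂ → k :* (x₁ :* y₂ :- x₂ :* y₁) := x₁ :* (k :* y₂ :- c :* y₁) :- (k :* x₂ :- c :* x₁) :* y₁)
          refl k c x₁ y₁ x₂ y₂) d≈0)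
    where
    k = polar s x₁ y₁ x₂ y₂
    c = eval K s x₂ y₂

  -- Rescaling the first column of (P Q) by 1/B(P, Q) turns s into XY.
  independent-roots⇒hyperbolic : ∀ s x₁ y₁ x₂ y₂ → ¬ disc s ≈ 0# → ¬ det x₁ x₂ y₁ y₂ ≈ 0# →
    eval K s x₁ y₁ ≈ 0# → eval K s x₂ y₂ ≈ 0# → IsHyperbolic K s
  independent-roots⇒hyperbolic s x₁ y₁ x₂ y₂ d≉0 T-inv r₁ r₂ =
    x₁ * k⁻¹ , x₂ , y₁ * k⁻¹ , y₂ , T′-inv , XX≈0 , XY≈1 , r₂
    where
    a = cXX s ; b = cXY s ; c = cYY s
    k = polar s x₁ y₁ x₂ y₂
    k≉0 : ¬ k ≈ 0#
    k≉0 = polar≉0 s x₁ y₁ x₂ y₂ d≉0 T-inv r₁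
    k⁻¹ = inv k k≉0

    T′-inv : ¬ det (x₁ * k⁻¹) x₂ (y₁ * k⁻¹) y₂ ≈ 0#
    T′-inv d≈0 = *-≉0 (inv≉0 k k≉0) T-inv (trans
      (solve 5 (λ k x₁ x₂ y₁ y₂ → k :* (x₁ :* y₂ :- x₂ :* y₁) := (x₁ :* k) :* y₂ :- x₂ :* (y₁ :* k)) refl k⁻¹ x₁ x₂ y₁ y₂) d≈0)

    XX≈0 : cXX (subst K (x₁ * k⁻¹) x₂ (y₁ * k⁻¹) y₂ s) ≈ 0#
    XX≈0 = begin
      cXX (subst K (x₁ * k⁻¹) x₂ (y₁ * k⁻¹) y₂ s) ≈⟨ solve 6 (λ a b c x₁ y₁ k →
        a :* (x₁ :* k) :* (x₁ :* k) :+ b :* (x₁ :* k) :* (y₁ :* k) :+ c :* (y₁ :* k) :* (y₁ :* k)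
        := (k :* k) :* (a :* x₁ :* x₁ :+ b :* x₁ :* y₁ :+ c :* y₁ :* y₁)) refl a b c x₁ y₁ k⁻¹ ⟩
      (k⁻¹ * k⁻¹) * eval K s x₁ y₁                ≈⟨ *-congˡ r₁ ⟩
      (k⁻¹ * k⁻¹) * 0#                            ≈⟨ zeroʳ _ ⟩
      0#                                          ∎

    XY≈1 : cXY (subst K (x₁ * k⁻¹) x₂ (y₁ * k⁻¹) y₂ s) ≈ 1#
    XY≈1 = begin
      cXY (subst K (x₁ * k⁻¹) x₂ (y₁ * k⁻¹) y₂ s) ≈⟨ solve 8 (λ a b c x₁ y₁ x₂ y₂ k →
        (a :* (x₁ :* k) :* x₂ :+ a :* (x₁ :* k) :* x₂) :+ b :* ((x₁ :* k) :* y₂ :+ x₂ :* (y₁ :* k))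
          :+ (c :* (y₁ :* k) :* y₂ :+ c :* (y₁ :* k) :* y₂)
        := ((a :* x₁ :* x₂ :+ a :* x₁ :* x₂) :+ b :* (x₁ :* y₂ :+ x₂ :* y₁) :+ (c :* y₁ :* y₂ :+ c :* y₁ :* y₂)) :* k)
        refl a b c x₁ y₁ x₂ y₂ k⁻¹ ⟩
      k * k⁻¹                                     ≈⟨ x*inv≈1 k k≉0 ⟩
      1#                                          ∎

  char2-shear-rank≤1 : two ≈ 0# → ∀ s r → cXY s ≈ 0# → cXX s * (r * r) ≈ cYY s → RankAtMost K s 1
  char2-shear-rank≤1 two≈0 s r b≈0 ar²≈c = shear-rank≤1 s r
    (begin
      a * r + a * r + b        ≈⟨ solve 3 (λ a b r → a :* r :+ a :* r :+ b := (:1 :+ :1) :* (a :* r) :+ b) refl a b r ⟩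
      two * (a * r) + b        ≈⟨ +-cong (*-congʳ two≈0) b≈0 ⟩
      0# * (a * r) + 0#        ≈⟨ solve 1 (λ x → :0 :* x :+ :0 := :0) refl (a * r) ⟩
      0#                       ∎)
    (begin
      a * (r * r) + b * r + c  ≈⟨ +-cong (+-cong ar²≈c (*-congʳ b≈0)) refl ⟩
      c + 0# * r + c           ≈⟨ solve 2 (λ c r → c :+ :0 :* r :+ c := (:1 :+ :1) :* c) refl c r ⟩
      two * c                  ≈⟨ *-congʳ two≈0 ⟩
      0# * c                   ≈⟨ zeroˡ c ⟩
      0#                       ∎)
    where a = cXX s ; b = cXY s ; c = cYY s

module ExtensionFacts {K L : Field} (e : Extension K L) where
  private
    module K = Field K
    module L = Field L
  open L using (_≈_)
  open Extension e
  open RingMorphisms.IsRingHomomorphism isHom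
  open FieldFacts K using (inv; x*inv≈1)
  module DK = BinaryForms K
  module DL = BinaryForms L

  ι-≉0 : ∀ {x} → ¬ x K.≈ K.0# → ¬ ι x ≈ L.0#
  ι-≉0 {x} x≉0 ιx≈0 = L.0≉1 (begin
    L.0#                     ≈⟨ L.sym (L.zeroˡ _) ⟩
    L.0# L.* ι (inv x x≉0)   ≈⟨ L.*-congʳ (L.sym ιx≈0) ⟩
    ι x L.* ι (inv x x≉0)    ≈⟨ L.sym (*-homo x _) ⟩
    ι (x K.* inv x x≉0)      ≈⟨ ⟦⟧-cong (x*inv≈1 x x≉0) ⟩
    ι K.1#                   ≈⟨ 1#-homo ⟩
    L.1#                     ∎)
    where open import Relation.Binary.Reasoning.Setoid L.setoid

  ι-≈0 : ∀ {x} → x K.≈ K.0# → ι x ≈ L.0#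
  ι-≈0 x≈0 = L.trans (⟦⟧-cong x≈0) 0#-homo

  ι-two : ι (K.1# K.+ K.1#) ≈ L.1# L.+ L.1#
  ι-two = L.trans (+-homo K.1# K.1#) (L.+-cong 1#-homo 1#-homo)

  private
    ι-- : ∀ x y → ι (x K.- y) ≈ ι x L.- ι y
    ι-- x y = L.trans (+-homo x (K.- y)) (L.+-congˡ (-‿homo y))

    ι-4ac : ∀ a c → ι (a K.* c K.+ a K.* c K.+ a K.* c K.+ a K.* c)
                    ≈ ι a L.* ι c L.+ ι a L.* ι c L.+ ι a L.* ι c L.+ ι a L.* ι c
    ι-4ac a c = L.trans (+-homo _ _) (L.+-cong (L.trans (+-homo _ _) (L.+-cong (L.trans (+-homo _ _)
                  (L.+-cong (*-homo a c) (*-homo a c))) (*-homo a c))) (*-homo a c))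

  ι-disc : ∀ s → ι (DK.disc s) ≈ DL.disc (mapForm K L ι s)
  ι-disc s = L.trans (ι-- _ _) (L.+-cong (*-homo (cXY s) (cXY s)) (L.-‿cong (ι-4ac (cXX s) (cYY s))))

  ι-discMixed : ∀ s t → ι (DK.discMixed s t) ≈ DL.discMixed (mapForm K L ι s) (mapForm K L ι t)
  ι-discMixed s t = L.trans (ι-- _ _) (L.+-cong (L.trans (+-homo _ _) (L.+-cong (*-homo _ _) (*-homo _ _)))
    (L.-‿cong (L.trans (+-homo _ _) (L.+-cong (L.trans (+-homo _ _) (L.+-cong (L.trans (+-homo _ _)
      (L.+-cong ι-m ι-m)) ι-m)) ι-m))))
    where
    ι-m : ι (cXX s K.* cYY t K.+ cXX t K.* cYY s) ≈ ι (cXX s) L.* ι (cYY t) L.+ ι (cXX t) L.* ι (cYY s)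
    ι-m = L.trans (+-homo _ _) (L.+-cong (*-homo _ _) (*-homo _ _))

-- M(√d) as pairs (x , y) standing for x + y √d.
module QuadraticExtension (M : Field) (d : Field.Carrier M)
  (d-nonsquare : ¬ Σ (Field.Carrier M) (λ r → Field._≈_ M (Field._*_ M r r) d)) where
  open Field M
  open FieldFacts M
  open IntegerCoefficients commRing using (solve; _:=_; _:+_; _:*_; _:-_; :-_; :0; :1)
  open import Relation.Binary.Reasoning.Setoid setoid

  private
    C : Set
    C = Carrier × Carrier

    _≈²_ : C → C → Set
    (x , y) ≈² (x′ , y′) = (x ≈ x′) × (y ≈ y′)

    _+²_ _*²_ : C → C → C
    (x , y) +² (x′ , y′) = (x + x′ , y + y′)
    (x , y) *² (x′ , y′) = (x * x′ + d * (y * y′) , x * y′ + y * x′)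

  commRing² : CommutativeRing 0ℓ 0ℓ
  commRing² = record
    { Carrier = C ; _≈_ = _≈²_ ; _+_ = _+²_ ; _*_ = _*²_
    ; -_ = λ (x , y) → (- x , - y) ; 0# = (0# , 0#) ; 1# = (1# , 0#)
    ; isCommutativeRing = record
      { isRing = record
        { +-isAbelianGroup = record
          { isGroup = record
            { isMonoid = record
              { isSemigroup = record
                { isMagma = record
                  { isEquivalence = record
                    { refl  = refl , refl
                    ; sym   = λ (p , q) → sym p , sym q
                    ; trans = λ (p , q) (p′ , q′) → trans p p′ , trans q q′ }
                  ; ∙-cong = λ (p , q) (p′ , q′) → +-cong p p′ , +-cong q q′ }
                ; assoc = λ (x , y) (x′ , y′) (x″ , y″) → +-assoc x x′ x″ , +-assoc y y′ y″ }
              ; identity = (λ (x , y) → +-identityˡ x , +-identityˡ y) , (λ (x , y) → +-identityʳ x , +-identityʳ y) }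
            ; inverse = (λ (x , y) → -‿inverseˡ x , -‿inverseˡ y) , (λ (x , y) → -‿inverseʳ x , -‿inverseʳ y)
            ; ⁻¹-cong = λ (p , q) → -‿cong p , -‿cong q }
          ; comm = λ (x , y) (x′ , y′) → +-comm x x′ , +-comm y y′ }
        ; *-cong = λ (p , q) (p′ , q′) → +-cong (*-cong p p′) (*-congˡ (*-cong q q′)) , +-cong (*-cong p q′) (*-cong q p′)
        ; *-assoc = λ (a , b) (c , e) (f , g) →
            solve 7 (λ d a b c e f g → (a :* c :+ d :* (b :* e)) :* f :+ d :* ((a :* e :+ b :* c) :* g)
                       := a :* (c :* f :+ d :* (e :* g)) :+ d :* (b :* (c :* g :+ e :* f))) refl d a b c e f g ,
            solve 7 (λ d a b c e f g → (a :* c :+ d :* (b :* e)) :* g :+ (a :* e :+ b :* c) :* f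
                       := a :* (c :* g :+ e :* f) :+ b :* (c :* f :+ d :* (e :* g))) refl d a b c e f g
        ; *-identity = (λ (a , b) → solve 3 (λ d a b → :1 :* a :+ d :* (:0 :* b) := a) refl d a b ,
                                    solve 2 (λ a b → :1 :* b :+ :0 :* a := b) refl a b) ,
                       (λ (a , b) → solve 3 (λ d a b → a :* :1 :+ d :* (b :* :0) := a) refl d a b ,
                                    solve 2 (λ a b → a :* :0 :+ b :* :1 := b) refl a b)
        ; distrib = (λ (a , b) (c , e) (f , g) →
                       solve 7 (λ d a b c e f g → a :* (c :+ f) :+ d :* (b :* (e :+ g)) := (a :* c :+ d :* (b :* e)) :+ (a :* f :+ d :* (b :* g))) refl d a b c e f g ,
                       solve 6 (λ a b c e f g → a :* (e :+ g) :+ b :* (c :+ f) := (a :* e :+ b :* c) :+ (a :* g :+ b :* f)) refl a b c e f g) ,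
                    (λ (a , b) (c , e) (f , g) →
                       solve 7 (λ d a b c e f g → (c :+ f) :* a :+ d :* ((e :+ g) :* b) := (c :* a :+ d :* (e :* b)) :+ (f :* a :+ d :* (g :* b))) refl d a b c e f g ,
                       solve 6 (λ a b c e f g → (c :+ f) :* b :+ (e :+ g) :* a := (c :* b :+ e :* a) :+ (f :* b :+ g :* a)) refl a b c e f g)
        }
      ; *-comm = λ (a , b) (c , e) →
          solve 5 (λ d a b c e → a :* c :+ d :* (b :* e) := c :* a :+ d :* (e :* b)) refl d a b c e ,
          solve 4 (λ a b c e → a :* e :+ b :* c := c :* b :+ e :* a) refl a b c e
      }
    }

  norm≉0 : ∀ x y → ¬ ((x ≈ 0#) × (y ≈ 0#)) → ¬ x * x - d * (y * y) ≈ 0#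
  norm≉0 x y xy≉0 N≈0 = ¬¬-excluded-middle λ where
      (yes y≈0) → x*x≈0⇒¬¬x≈0 x (x²≈0 y≈0) (λ x≈0 → xy≉0 (x≈0 , y≈0))
      (no y≉0)  → d-nonsquare (x * inv y y≉0 , x/y-squared y≉0)
    where
    x²≈0 : y ≈ 0# → x * x ≈ 0#
    x²≈0 y≈0 = begin
      x * x                               ≈⟨ solve 3 (λ d x y → x :* x := (x :* x :- d :* (y :* y)) :+ d :* (y :* y)) refl d x y ⟩
      (x * x - d * (y * y)) + d * (y * y) ≈⟨ +-cong N≈0 (*-congˡ (*-cong y≈0 y≈0)) ⟩
      0# + d * (0# * 0#)                  ≈⟨ solve 1 (λ d → :0 :+ d :* (:0 :* :0) := :0) refl d ⟩
      0#                                  ∎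

    x/y-squared : (y≉0 : ¬ y ≈ 0#) → (x * inv y y≉0) * (x * inv y y≉0) ≈ d
    x/y-squared y≉0 = begin
      (x * y⁻¹) * (x * y⁻¹)                      ≈⟨ solve 4 (λ d x y y⁻¹ → (x :* y⁻¹) :* (x :* y⁻¹)
        := (x :* x :- d :* (y :* y)) :* (y⁻¹ :* y⁻¹) :+ d :* ((y :* y⁻¹) :* (y :* y⁻¹))) refl d x y y⁻¹ ⟩
      (x * x - d * (y * y)) * (y⁻¹ * y⁻¹) + d * ((y * y⁻¹) * (y * y⁻¹))
                                                 ≈⟨ +-cong (*-congʳ N≈0) (*-congˡ (*-cong (x*inv≈1 y y≉0) (x*inv≈1 y y≉0))) ⟩
      0# * (y⁻¹ * y⁻¹) + d * (1# * 1#)           ≈⟨ solve 2 (λ d y⁻¹ → :0 :* (y⁻¹ :* y⁻¹) :+ d :* (:1 :* :1) := d) refl d y⁻¹ ⟩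
      d                                          ∎
      where y⁻¹ = inv y y≉0

  field² : Field
  field² = record
    { commRing = commRing²
    ; 0≉1      = λ (0≈1 , _) → 0≉1 0≈1
    ; inverse  = λ (x , y) xy≉0 →
        let N⁻¹ = inv (x * x - d * (y * y)) (norm≉0 x y xy≉0) in
        (x * N⁻¹ , - (y * N⁻¹)) ,
        trans (solve 4 (λ d x y N⁻¹ → x :* (x :* N⁻¹) :+ d :* (y :* (:- (y :* N⁻¹))) := (x :* x :- d :* (y :* y)) :* N⁻¹) refl d x y N⁻¹)
              (x*inv≈1 _ (norm≉0 x y xy≉0)) ,
        solve 3 (λ x y N⁻¹ → x :* (:- (y :* N⁻¹)) :+ y :* (x :* N⁻¹) := :0) refl x y N⁻¹
    }

  inclusion : Extension M field²
  inclusion = record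
    { ι     = λ x → (x , 0#)
    ; isHom = record
      { isSemiringHomomorphism = record
        { isNearSemiringHomomorphism = record
          { +-isMonoidHomomorphism = record
            { isMagmaHomomorphism = record
              { isRelHomomorphism = record { cong = λ x≈y → x≈y , refl }
              ; homo = λ _ _ → refl , sym (+-identityʳ 0#) }
            ; ε-homo = refl , refl }
          ; *-homo = λ x y → solve 3 (λ d x y → x :* y := x :* y :+ d :* (:0 :* :0)) refl d x y ,
                             solve 2 (λ x y → :0 := x :* :0 :+ :0 :* y) refl x y }
        ; 1#-homo = refl , refl }
      ; -‿homo = λ _ → refl , solve 0 (:0 := :- :0) refl }
    }

-- In characteristic 2, a X² + c Y² = a (X + r Y)² for r² = c / a, and such r exists in M or in M(√(c / a)).
char2-diagonal-degenerates : ∀ (M : Field) → Field._≈_ M (Field._+_ M (Field.1# M) (Field.1# M)) (Field.0# M) →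
  ∀ s → Field._≈_ M (cXY s) (Field.0# M) →
  ¬ (∀ L (e : Extension M L) → ¬ RankAtMost L (mapForm M L (Extension.ι e) s) 1)
char2-diagonal-degenerates M two≈0 s b≈0 ¬rank≤1 = ¬¬-excluded-middle λ where
    (yes a≈0) → ¬rank≤1 M idExtension (a≈0∧b≈0⇒rank≤1 s a≈0 b≈0)
    (no a≉0)  → ¬¬-excluded-middle {A = Σ Carrier λ r → r * r ≈ c * inv a a≉0} λ where
      (yes (r , r²≈c/a)) → ¬rank≤1 M idExtension (char2-shear-rank≤1 two≈0 s r b≈0 (begin
          a * (r * r)          ≈⟨ *-congˡ r²≈c/a ⟩
          a * (c * inv a a≉0)  ≈⟨ a*[c/a]≈c a≉0 ⟩
          c                    ∎))
      (no c/a-nonsquare) → let open QuadraticExtension M (c * inv a a≉0) c/a-nonsquare in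
        ¬rank≤1 field² inclusion (BinaryForms.char2-shear-rank≤1 field² (two≈0 , solve 0 (:0 :+ :0 := :0) refl)
          (mapForm M field² (Extension.ι inclusion) s) (0# , 1#) (b≈0 , refl)
          (trans (solve 2 (λ a d → a :* (:0 :* :0 :+ d :* (:1 :* :1)) :+ d :* (:0 :* (:0 :* :1 :+ :1 :* :0)) := a :* d) refl a (c * inv a a≉0))
                 (a*[c/a]≈c a≉0) ,
           solve 2 (λ a d → a :* (:0 :* :1 :+ :1 :* :0) :+ :0 :* (:0 :* :0 :+ d :* (:1 :* :1)) := :0) refl a (c * inv a a≉0)))
  where
  open Field M
  open FieldFacts M
  open BinaryForms M
  open IntegerCoefficients commRing using (solve; _:=_; _:+_; _:*_; :0; :1)
  open import Relation.Binary.Reasoning.Setoid setoid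
  a = cXX s ; c = cYY s

  a*[c/a]≈c : (a≉0 : ¬ a ≈ 0#) → a * (c * inv a a≉0) ≈ c
  a*[c/a]≈c a≉0 = begin
    a * (c * inv a a≉0)    ≈⟨ solve 3 (λ a c a⁻¹ → a :* (c :* a⁻¹) := (a :* a⁻¹) :* c) refl a c (inv a a≉0) ⟩
    (a * inv a a≉0) * c    ≈⟨ *-congʳ (x*inv≈1 a a≉0) ⟩
    1# * c                 ≈⟨ *-identityˡ c ⟩
    c                      ∎

module FiniteFieldFacts (F : FiniteField) where
  open FiniteField F using (card; enum; enum-inj; enum-surj) renaming (field′ to K)
  open Field K hiding (zero)
  open FieldFacts K
  open BinaryForms K
  open IntegerCoefficients commRing using (solve; _:=_; _:*_; _:-_; :-_; :0; :1)
  open import Relation.Binary.Reasoning.Setoid setoid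

  _≟_ : ∀ x y → Dec (x ≈ y)
  x ≟ y with enum-surj x | enum-surj y
  ... | i , i↦x | j , j↦y with i Fin.≟ j
  ...   | yes ≡.refl = yes (trans (sym i↦x) j↦y)
  ...   | no i≢j     = no λ x≈y → i≢j (enum-inj i j (trans i↦x (trans x≈y (sym j↦y))))

  ≈-stable : ∀ {x y} → ¬ ¬ x ≈ y → x ≈ y
  ≈-stable {x} {y} ¬¬x≈y with x ≟ y
  ... | yes x≈y = x≈y
  ... | no x≉y  = ⊥-elim (¬¬x≈y x≉y)

  -- The projective line: (0 , 1) and the points (1 , u).
  point : Fin (suc card) → Carrier × Carrier
  point zero    = (0# , 1#)
  point (suc i) = (1# , enum i)

  px py : Fin (suc card) → Carrier
  px j = proj₁ (point j)
  py j = proj₂ (point j)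

  point≉0 : ∀ j → ¬ ((px j ≈ 0#) × (py j ≈ 0#))
  point≉0 zero    (_ , 1≈0) = 0≉1 (sym 1≈0)
  point≉0 (suc i) (1≈0 , _) = 0≉1 (sym 1≈0)

  point-independent : ∀ {i j} → i ≢ j → ¬ det (px i) (px j) (py i) (py j) ≈ 0#
  point-independent {zero}  {zero}  i≢j _   = i≢j ≡.refl
  point-independent {zero}  {suc j} _   d≈0 = -1≉0 (trans (solve 1 (λ u → :- :1 := :0 :* u :- :1 :* :1) refl (enum j)) d≈0)
  point-independent {suc i} {zero}  _   d≈0 = 0≉1 (sym (trans (solve 1 (λ u → :1 := :1 :* :1 :- :0 :* u) refl (enum i)) d≈0))
  point-independent {suc i} {suc j} i≢j d≈0 = i≢j (≡.cong suc (enum-inj i j (sym (x-y≈0⇒x≈y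
    (trans (solve 2 (λ u v → v :- u := :1 :* v :- :1 :* u) refl (enum i) (enum j)) d≈0)))))

  representative : ∀ x y → ¬ ((x ≈ 0#) × (y ≈ 0#)) →
    Σ (Fin (suc card)) λ j → Σ Carrier λ l → (¬ l ≈ 0#) × (x ≈ l * px j) × (y ≈ l * py j)
  representative x y xy≉0 with x ≟ 0#
  ... | yes x≈0 = zero , y , (λ y≈0 → xy≉0 (x≈0 , y≈0)) , trans x≈0 (sym (zeroʳ y)) , sym (*-identityʳ y)
  ... | no x≉0  = suc i , x , x≉0 , sym (*-identityʳ x) , (begin
      y                    ≈⟨ sym (*-identityˡ y) ⟩
      1# * y               ≈⟨ *-congʳ (sym (x*inv≈1 x x≉0)) ⟩
      (x * inv x x≉0) * y  ≈⟨ solve 3 (λ x x⁻¹ y → (x :* x⁻¹) :* y := x :* (y :* x⁻¹)) refl x (inv x x≉0) y ⟩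
      x * (y * inv x x≉0)  ≈⟨ *-congˡ (sym i↦y/x) ⟩
      x * enum i           ∎)
    where
    i = proj₁ (enum-surj (y * inv x x≉0))
    i↦y/x : enum i ≈ y * inv x x≉0
    i↦y/x = proj₂ (enum-surj (y * inv x x≉0))

  representative-unique : ∀ {l l′ i i′} → ¬ l ≈ 0# → ¬ l′ ≈ 0# →
    l * px i ≈ l′ * px i′ → l * py i ≈ l′ * py i′ → (i ≡ i′) × (l ≈ l′)
  representative-unique {l} {l′} {zero}  {zero}   _ _ _ y≈ = ≡.refl , trans (sym (*-identityʳ l)) (trans y≈ (*-identityʳ l′))
  representative-unique {l} {l′} {zero}  {suc _} _ l′≉0 x≈ _ = ⊥-elim (l′≉0 (trans (sym (*-identityʳ l′)) (trans (sym x≈) (zeroʳ l))))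
  representative-unique {l} {l′} {suc _} {zero}  l≉0 _ x≈ _ = ⊥-elim (l≉0 (trans (sym (*-identityʳ l)) (trans x≈ (zeroʳ l′))))
  representative-unique {l} {l′} {suc j} {suc j′} l≉0 _ x≈ y≈ = ≡.cong suc (enum-inj j j′ u≈u′) , l≈l′
    where
    l≈l′ : l ≈ l′
    l≈l′ = trans (sym (*-identityʳ l)) (trans x≈ (*-identityʳ l′))
    u≈u′ : enum j ≈ enum j′
    u≈u′ = x-y≈0⇒x≈y (x*y≈0⇒y≈0 l≉0 (begin
      l * (enum j - enum j′)          ≈⟨ solve 3 (λ l u u′ → l :* (u :- u′) := l :* u :- l :* u′) refl l (enum j) (enum j′) ⟩
      l * enum j - l * enum j′        ≈⟨ +-congˡ (-‿cong (*-congʳ l≈l′)) ⟩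
      l * enum j - l′ * enum j′       ≈⟨ +-congʳ y≈ ⟩
      l′ * enum j′ - l′ * enum j′     ≈⟨ -‿inverseʳ _ ⟩
      0#                              ∎))

  IsRoot : BinForm K → Fin (suc card) → Set
  IsRoot t j = eval K t (px j) (py j) ≈ 0#

  IsRoot? : ∀ t j → Dec (IsRoot t j)
  IsRoot? t j = eval K t (px j) (py j) ≟ 0#

  root-representative : ∀ t {x y} (xy≉0 : ¬ ((x ≈ 0#) × (y ≈ 0#))) → eval K t x y ≈ 0# →
    IsRoot t (proj₁ (representative x y xy≉0))
  root-representative t {x} {y} xy≉0 r with representative x y xy≉0
  ... | j , l , l≉0 , x≈ , y≈ = x*y≈0⇒y≈0 (*-≉0 l≉0 l≉0) (begin
    (l * l) * eval K t (px j) (py j)    ≈⟨ sym (eval-homogeneous t l (px j) (py j)) ⟩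
    eval K t (l * px j) (l * py j)      ≈⟨ eval-cong t (sym x≈) (sym y≈) ⟩
    eval K t x y                        ≈⟨ r ⟩
    0#                                  ∎)

  roots≤2 : ∀ t → ¬ IsZero t → AtMostTwo (IsRoot t)
  roots≤2 t t≉0 i j k rᵢ rⱼ rₖ with i Fin.≟ j | i Fin.≟ k | j Fin.≟ k
  ... | yes i≡j | _       | _       = inj₁ i≡j
  ... | no _    | yes i≡k | _       = inj₂ (inj₁ i≡k)
  ... | no _    | no _    | yes j≡k = inj₂ (inj₂ j≡k)
  ... | no i≢j  | no i≢k  | no j≢k  = ⊥-elim (t≉0 (three-independent-roots⇒zero t _ _ _ _ _ _
    (point-independent i≢j) (point-independent i≢k) (point-independent j≢k) rᵢ rⱼ rₖ))

  degenerate-roots≤1 : ∀ t → ¬ IsZero t → disc t ≈ 0# → AtMostOne (IsRoot t)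
  degenerate-roots≤1 t t≉0 d≈0 i j rᵢ rⱼ with i Fin.≟ j
  ... | yes i≡j = i≡j
  ... | no i≢j  = ⊥-elim (t≉0 (polar≈0⇒zero t _ _ _ _ (point-independent i≢j) rᵢ rⱼ B≈0))
    where
    B = polar t (px i) (py i) (px j) (py j)
    B≈0 : B ≈ 0#
    B≈0 = ≈-stable (x*x≈0⇒¬¬x≈0 B (trans (polar²≈det²·disc t _ _ _ _ rᵢ)
            (trans (*-congˡ d≈0) (zeroʳ _))))

  private
    complement : Fin (suc card) → Carrier × Carrier
    complement zero    = (1# , 0#)
    complement (suc _) = (0# , 1#)

    complement-independent : ∀ j → ¬ det (px j) (proj₁ (complement j)) (py j) (proj₂ (complement j)) ≈ 0#
    complement-independent zero    d≈0 = -1≉0 (trans (solve 0 (:- :1 := :0 :* :0 :- :1 :* :1) refl) d≈0)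
    complement-independent (suc i) d≈0 = 0≉1 (sym (trans (solve 1 (λ u → :1 := :1 :* :1 :- :0 :* u) refl (enum i)) d≈0))

  independent⇒other-representative : ∀ j {x y} (xy≉0 : ¬ ((x ≈ 0#) × (y ≈ 0#))) →
    ¬ det (px j) x (py j) y ≈ 0# → j ≢ proj₁ (representative x y xy≉0)
  independent⇒other-representative j {x} {y} xy≉0 d≉0 with representative x y xy≉0
  ... | _ , l , _ , x≈ , y≈ = λ where
    ≡.refl → d≉0 (begin
      px j * y - x * py j                   ≈⟨ +-cong (*-congˡ y≈) (-‿cong (*-congʳ x≈)) ⟩
      px j * (l * py j) - (l * px j) * py j ≈⟨ solve 3 (λ u v l → u :* (l :* v) :- (l :* u) :* v := :0) refl (px j) (py j) l ⟩
      0#                                    ∎)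

  second-point-root : ∀ t → ¬ disc t ≈ 0# → ∀ j → IsRoot t j → Σ (Fin (suc card)) λ j′ → (j ≢ j′) × IsRoot t j′
  second-point-root t d≉0 j rⱼ =
    proj₁ (representative x y R≉0) ,
    independent⇒other-representative j R≉0 (proj₂ R-root) ,
    root-representative t R≉0 (proj₁ R-root)
    where
    x₂ = proj₁ (complement j) ; y₂ = proj₂ (complement j)
    k = polar t (px j) (py j) x₂ y₂
    c = eval K t x₂ y₂
    x = k * x₂ - c * px j ; y = k * y₂ - c * py j

    R-root : (eval K t x y ≈ 0#) × ¬ det (px j) x (py j) y ≈ 0#
    R-root = second-root t (px j) (py j) x₂ y₂ d≉0 (complement-independent j) rⱼ

    R≉0 : ¬ ((x ≈ 0#) × (y ≈ 0#))
    R≉0 = det≉0⇒column≉0 (proj₂ R-root)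

  isotropic⇒root : ∀ t {x y} → ¬ ((x ≈ 0#) × (y ≈ 0#)) → eval K t x y ≈ 0# → Σ (Fin (suc card)) (IsRoot t)
  isotropic⇒root t {x} {y} xy≉0 r = proj₁ (representative x y xy≉0) , root-representative t xy≉0 r

  odd-degenerate-has-root : ¬ two ≈ 0# → ∀ t → disc t ≈ 0# → ¬ ¬ Σ (Fin (suc card)) (IsRoot t)
  odd-degenerate-has-root two≉0 t d≈0 ¬root = disc≈0⇒¬¬rank≤1 two≉0 t d≈0 λ rank≤1 →
    let (x , y , xy≉0 , r) = rank≤1⇒isotropic t rank≤1 in ¬root (isotropic⇒root t xy≉0 r)

  rootless⇒anisotropic : ∀ t → ¬ disc t ≈ 0# → (∀ j → ¬ IsRoot t j) → IsAnisotropicRank2 K t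
  rootless⇒anisotropic t d≉0 no-root = disc≉0⇒rank2 t d≉0 , λ x y xy≉0 r →
    let (j , rⱼ) = isotropic⇒root t xy≉0 r in no-root j rⱼ

  root⇒hyperbolic : ∀ t → ¬ disc t ≈ 0# → ∀ j → IsRoot t j → IsHyperbolic K t
  root⇒hyperbolic t d≉0 j rⱼ =
    let (j′ , j≢j′ , rⱼ′) = second-point-root t d≉0 j rⱼ in
    independent-roots⇒hyperbolic t (px j) (py j) (px j′) (py j′) d≉0 (point-independent j≢j′) rⱼ rⱼ′

  IsZero? : ∀ t → Dec (IsZero t)
  IsZero? t with cXX t ≟ 0# | cXY t ≟ 0# | cYY t ≟ 0#
  ... | yes a≈0 | yes b≈0 | yes c≈0 = yes (a≈0 , b≈0 , c≈0)
  ... | no a≉0  | _       | _       = no (a≉0 ∘ proj₁)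
  ... | yes _   | no b≉0  | _       = no (b≉0 ∘ proj₁ ∘ proj₂)
  ... | yes _   | yes _   | no c≉0  = no (c≉0 ∘ proj₂ ∘ proj₂)

module ScaledPoints (F : FiniteField) where
  open FiniteField F using (card; enum; enum-inj; enum-surj) renaming (field′ to K)
  open Field K hiding (zero)
  open FieldFacts K
  open FiniteFieldFacts F

  NonZero? : ∀ i → Dec (¬ enum i ≈ 0#)
  NonZero? i = ¬? (enum i ≟ 0#)

  #nonzero≡q∸1 : count NonZero? ≡ card ∸ 1
  #nonzero≡q∸1 = ≡.trans (≡.sym (ℕ.m+n∸m≡n 1 (count NonZero?)))
    (≡.cong (_∸ 1) (≡.trans (≡.cong (ℕ._+ count NonZero?) (≡.sym #zero≡1)) (count-¬ (λ i → enum i ≟ 0#))))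
    where
    #zero≡1 : count (λ i → enum i ≟ 0#) ≡ 1
    #zero≡1 = ℕ.≤-antisym (count≤1 (λ i → enum i ≟ 0#) (λ i j i↦0 j↦0 → enum-inj i j (trans i↦0 (sym j↦0))))
                          (count≥1 (λ i → enum i ≟ 0#) (proj₁ (enum-surj 0#)) (proj₂ (enum-surj 0#)))

  -- Fin (|C| · (q − 1)) ≅ Fin |C| × Fin (q − 1) indexes the pairs l · point i with C i and l ≉ 0.
  scaled-points : ∀ {C : Pred (Fin (suc card)) 0ℓ} (C? : Decidable C) (P : BinForm K → Set) s₁ s₂ →
    (∀ l i → ¬ l ≈ 0# → C i → P (lincomb K (l * px i) s₁ (l * py i) s₂)) →
    AtLeastPairs K (count C? ℕ.* count NonZero?) P s₁ s₂
  scaled-points {C} C? P s₁ s₂ P-scaled = pair , injective , nonzero , λ k → P-scaled (l k) (i k) (l≉0 k) (C-i k)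
    where
    m = count C?
    N = count NonZero?
    i : Fin (m ℕ.* N) → Fin (suc card)
    i k = enumerate C? (proj₁ (remQuot {m} N k))
    l : Fin (m ℕ.* N) → Carrier
    l k = enum (enumerate NonZero? (proj₂ (remQuot {m} N k)))
    l≉0 : ∀ k → ¬ l k ≈ 0#
    l≉0 k = enumerate-sound NonZero? (proj₂ (remQuot {m} N k))
    C-i : ∀ k → C (i k)
    C-i k = enumerate-sound C? (proj₁ (remQuot {m} N k))

    pair : Fin (m ℕ.* N) → Carrier × Carrier
    pair k = (l k * px (i k) , l k * py (i k))

    injective : ∀ k k′ → proj₁ (pair k) ≈ proj₁ (pair k′) → proj₂ (pair k) ≈ proj₂ (pair k′) → k ≡ k′
    injective k k′ x≈ y≈ = ≡.trans (≡.sym (Fin.combine-remQuot {m} N k))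
      (≡.trans (≡.cong (uncurry combine) (≡.cong₂ _,_ i≡ l≡)) (Fin.combine-remQuot {m} N k′))
      where
      same : (i k ≡ i k′) × (l k ≈ l k′)
      same = representative-unique (l≉0 k) (l≉0 k′) x≈ y≈
      i≡ : proj₁ (remQuot {m} N k) ≡ proj₁ (remQuot {m} N k′)
      i≡ = enumerate-injective C? _ _ (proj₁ same)
      l≡ : proj₂ (remQuot {m} N k) ≡ proj₂ (remQuot {m} N k′)
      l≡ = enumerate-injective NonZero? _ _ (enum-inj _ _ (proj₂ same))

    nonzero : ∀ k → ¬ ((proj₁ (pair k) ≈ 0#) × (proj₂ (pair k) ≈ 0#))
    nonzero k (x≈0 , y≈0) = point≉0 (i k) (x*y≈0⇒y≈0 (l≉0 k) x≈0 , x*y≈0⇒y≈0 (l≉0 k) y≈0)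

module MaximalRank {K : Field} (s₁ s₂ : BinForm K) (r≡2 : MaxRankIs2 K s₁ s₂) where
  open Field K
  open BinaryForms K
  open FieldFacts K using (two)
  private
    M = proj₁ r≡2
    e = proj₁ (proj₂ r≡2)
    a = proj₁ (proj₂ (proj₂ r≡2))
    b = proj₁ (proj₂ (proj₂ (proj₂ r≡2)))
    module M = Field M
    module MF = FieldFacts M
    module MB = BinaryForms M
    module MS = IntegerCoefficients M.commRing
    open ExtensionFacts e
    ι = Extension.ι e
    t = lincomb M a (mapForm K M ι s₁) b (mapForm K M ι s₂)

    rank2 : ∀ L (e′ : Extension M L) → HasRank L (mapForm M L (Extension.ι e′) t) 2
    rank2 = proj₂ (proj₂ (proj₂ (proj₂ (proj₂ r≡2))))

  -- Otherwise disc (a s₁ + b s₂) ≈ 0 over M, so the rank-2 form t would have rank ≤ 1.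
  odd⇒discForm≉0 : ¬ two ≈ 0# → ¬ IsZero (discForm s₁ s₂)
  odd⇒discForm≉0 two≉0 (D₁≈0 , Dₘ≈0 , D₂≈0) =
    MB.disc≈0⇒¬¬rank≤1 (λ two≈0 → ι-≉0 two≉0 (M.trans ι-two two≈0)) t disc-t≈0
      (proj₂ (rank2 M MF.idExtension) 1 (s≤s (s≤s z≤n)))
    where
    disc-t≈0 : MB.disc t M.≈ M.0#
    disc-t≈0 = M.trans (MB.disc-lincomb a b _ _) (M.trans
      (M.+-cong (M.+-cong (M.*-congʳ (M.*-congʳ (M.trans (M.sym (ι-disc s₁)) (ι-≈0 D₁≈0))))
                          (M.*-congʳ (M.*-congʳ (M.trans (M.sym (ι-discMixed s₁ s₂)) (ι-≈0 Dₘ≈0)))))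
                (M.*-congʳ (M.*-congʳ (M.trans (M.sym (ι-disc s₂)) (ι-≈0 D₂≈0)))))
      (MS.solve 2 (λ a b → MS.:0 MS.:* a MS.:* a MS.:+ MS.:0 MS.:* a MS.:* b MS.:+ MS.:0 MS.:* b MS.:* b MS.:= MS.:0) M.refl a b))

  even⇒XY≉0 : two ≈ 0# → ¬ ((cXY s₁ ≈ 0#) × (cXY s₂ ≈ 0#))
  even⇒XY≉0 two≈0 (b₁≈0 , b₂≈0) =
    char2-diagonal-degenerates M (M.trans (M.sym ι-two) (ι-≈0 two≈0)) t XY≈0
      (λ L e′ → proj₂ (rank2 L e′) 1 (s≤s (s≤s z≤n)))
    where
    XY≈0 : cXY t M.≈ M.0#
    XY≈0 = M.trans (M.+-cong (M.*-congˡ (ι-≈0 b₁≈0)) (M.*-congˡ (ι-≈0 b₂≈0)))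
             (MS.solve 2 (λ a b → a MS.:* MS.:0 MS.:+ b MS.:* MS.:0 MS.:= MS.:0) M.refl a b)

module FinitePencil (F : FiniteField) (s₁ s₂ : BinForm (FiniteField.field′ F))
  (coprime : NoCommonFactor (FiniteField.field′ F) s₁ s₂) where
  open FiniteField F using (card; enum) renaming (field′ to K)
  open Field K hiding (zero)
  open FieldFacts K
  open BinaryForms K
  open FiniteFieldFacts F
  open IntegerCoefficients commRing using (solve; _:=_; _:+_; _:*_; _:-_; :-_; :0; :1)
  open import Relation.Binary.Reasoning.Setoid setoid

  -- u X + v Y is the linear form vanishing at point j.
  line-u line-v : Fin (suc card) → Carrier
  line-u zero    = 1#
  line-u (suc i) = enum i
  line-v zero    = 0#
  line-v (suc _) = - 1#

  line≉0 : ∀ j → ¬ ((line-u j ≈ 0#) × (line-v j ≈ 0#))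
  line≉0 zero    (1≈0 , _)  = 0≉1 (sym 1≈0)
  line≉0 (suc _) (_ , -1≈0) = -1≉0 -1≈0

  root⇒line-factor : ∀ s j → IsRoot s j → Σ Carrier λ p → Σ Carrier λ q →
    _≈F_ K s (form (line-u j * p) (line-u j * q + line-v j * p) (line-v j * q))
  root⇒line-factor s zero r = a , b ,
      sym (*-identityˡ a) ,
      solve 2 (λ a b → b := :1 :* b :+ :0 :* a) refl a b ,
      trans (trans (solve 3 (λ a b c → c := a :* :0 :* :0 :+ b :* :0 :* :1 :+ c :* :1 :* :1) refl a b c) r) (sym (zeroˡ b))
    where a = cXX s ; b = cXY s ; c = cYY s
  root⇒line-factor s (suc i) r = - (c * u) - b , - c ,
      trans (solve 4 (λ a b c u → a := u :* (:- (c :* u) :- b) :+ (a :* :1 :* :1 :+ b :* :1 :* u :+ c :* u :* u)) refl a b c u)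
            (trans (+-congˡ r) (+-identityʳ _)) ,
      solve 3 (λ b c u → b := u :* (:- c) :+ (:- :1) :* (:- (c :* u) :- b)) refl b c u ,
      solve 1 (λ c → c := (:- :1) :* (:- c)) refl c
    where a = cXX s ; b = cXY s ; c = cYY s ; u = enum i

  no-common-root : ∀ j → ¬ (IsRoot s₁ j × IsRoot s₂ j)
  no-common-root j (r₁ , r₂) =
    coprime (inj₁ (line-u j , line-v j , line≉0 j , root⇒line-factor s₁ j r₁ , root⇒line-factor s₂ j r₂))

  Multiple : BinForm K → BinForm K → Set
  Multiple s g = Σ Carrier λ k → _≈F_ K s (form (k * cXX g) (k * cXY g) (k * cYY g))

  multiple-refl : ∀ g → Multiple g g
  multiple-refl g = 1# , sym (*-identityˡ _) , sym (*-identityˡ _) , sym (*-identityˡ _)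

  zero-multiple : ∀ {s} g → IsZero s → Multiple s g
  zero-multiple g (a≈0 , b≈0 , c≈0) = 0# , trans a≈0 (sym (zeroˡ _)) , trans b≈0 (sym (zeroˡ _)) , trans c≈0 (sym (zeroˡ _))

  member : Fin (suc card) → BinForm K
  member i = lincomb K (px i) s₁ (py i) s₂

  member≉0 : ∀ i → ¬ IsZero (member i)
  member≉0 i member≈0 with IsZero? s₂ | IsZero? s₁
  ... | yes s₂≈0 | yes s₁≈0 = coprime (inj₂ (X² , X²≉0 , zero-multiple X² s₁≈0 , zero-multiple X² s₂≈0))
    where
    X² = form 1# 0# 0#
    X²≉0 : ¬ ((1# ≈ 0#) × (0# ≈ 0#) × (0# ≈ 0#))
    X²≉0 (1≈0 , _) = 0≉1 (sym 1≈0)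
  ... | yes s₂≈0 | no s₁≉0  = coprime (inj₂ (s₁ , s₁≉0 , multiple-refl s₁ , zero-multiple s₁ s₂≈0))
  ... | no s₂≉0  | _        = s₂-multiple i member≈0
    where
    s₂-multiple : ∀ i → IsZero (member i) → ⊥
    s₂-multiple zero    (a≈0 , b≈0 , c≈0) = s₂≉0 (drop a≈0 , drop b≈0 , drop c≈0)
      where
      drop : ∀ {x y} → 0# * x + 1# * y ≈ 0# → y ≈ 0#
      drop {x} {y} e = trans (solve 2 (λ x y → y := :0 :* x :+ :1 :* y) refl x y) e
    s₂-multiple (suc j) (a≈0 , b≈0 , c≈0) =
      coprime (inj₂ (s₂ , s₂≉0 , (- u , move a≈0 , move b≈0 , move c≈0) , multiple-refl s₂))
      where
      u = enum j
      move : ∀ {x y} → 1# * x + u * y ≈ 0# → x ≈ (- u) * y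
      move {x} {y} e = trans (solve 3 (λ x y u → x := (:1 :* x :+ u :* y) :+ (:- u) :* y) refl x y u)
                             (trans (+-congʳ e) (+-identityˡ _))

  member-root : ∀ i j → IsRoot (member i) j → px i * eval K s₁ (px j) (py j) + py i * eval K s₂ (px j) (py j) ≈ 0#
  member-root i j r = trans (sym (eval-lincomb (px i) (py i) s₁ s₂ (px j) (py j))) r

  unique-member : ∀ j → count (λ i → IsRoot? (member i) j) ≡ 1
  unique-member j = ℕ.≤-antisym (count≤1 (λ i → IsRoot? (member i) j) at-most-one)
                                (count≥1 (λ i → IsRoot? (member i) j) (proj₁ some-member) (proj₂ some-member))
    where
    S₁ = eval K s₁ (px j) (py j)
    S₂ = eval K s₂ (px j) (py j)

    at-most-one : AtMostOne (λ i → IsRoot (member i) j)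
    at-most-one i i′ rᵢ rᵢ′ with i Fin.≟ i′
    ... | yes i≡i′ = i≡i′
    ... | no i≢i′  = ⊥-elim (no-common-root j
          (det≉0⇒trivial-solution (point-independent i≢i′) (member-root i j rᵢ) (member-root i′ j rᵢ′)))

    S₂-S₁≉0 : ¬ ((S₂ ≈ 0#) × (- S₁ ≈ 0#))
    S₂-S₁≉0 (S₂≈0 , -S₁≈0) = no-common-root j
      (trans (solve 1 (λ x → x := :- (:- x)) refl S₁) (trans (-‿cong -S₁≈0) (solve 0 (:- :0 := :0) refl)) , S₂≈0)

    -- The member S₂(P) s₁ − S₁(P) s₂ vanishes at P.
    some-member : Σ (Fin (suc card)) λ i → IsRoot (member i) j
    some-member with representative S₂ (- S₁) S₂-S₁≉0
    ... | i , l , l≉0 , S₂≈ , -S₁≈ = i , x*y≈0⇒y≈0 l≉0 (begin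
      l * eval K (member i) (px j) (py j)    ≈⟨ *-congˡ (eval-lincomb (px i) (py i) s₁ s₂ (px j) (py j)) ⟩
      l * (px i * S₁ + py i * S₂)            ≈⟨ solve 5 (λ l x y S₁ S₂ → l :* (x :* S₁ :+ y :* S₂) := (l :* x) :* S₁ :+ (l :* y) :* S₂) refl l (px i) (py i) S₁ S₂ ⟩
      (l * px i) * S₁ + (l * py i) * S₂      ≈⟨ +-cong (*-congʳ (sym S₂≈)) (*-congʳ (sym -S₁≈)) ⟩
      S₂ * S₁ + (- S₁) * S₂                  ≈⟨ solve 2 (λ x y → y :* x :+ (:- x) :* y := :0) refl S₁ S₂ ⟩
      0#                                     ∎)

  roots : Fin (suc card) → ℕ
  roots i = count (IsRoot? (member i))

  ∑roots≡q+1 : sum roots ≡ suc card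
  ∑roots≡q+1 = ≡.trans (∑-comm (λ i j → indicator (IsRoot? (member i) j)))
                (≡.trans (sum-cong unique-member) (sum-ones (suc card)))

  Degenerate : Fin (suc card) → Set
  Degenerate i = disc (member i) ≈ 0#

  Degenerate? : ∀ i → Dec (Degenerate i)
  Degenerate? i = disc (member i) ≟ 0#

  roots-member≤2 : ∀ i → roots i ≤ 2
  roots-member≤2 i = count≤2 (IsRoot? (member i)) (roots≤2 (member i) (member≉0 i))

  degenerate⇒roots≤1 : ∀ i → Degenerate i → roots i ≤ 1
  degenerate⇒roots≤1 i d≈0 = count≤1 (IsRoot? (member i)) (degenerate-roots≤1 (member i) (member≉0 i) d≈0)

  nondegenerate⇒roots≢1 : ∀ i → ¬ Degenerate i → 1 ≤ roots i → 2 ≤ roots i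
  nondegenerate⇒roots≢1 i d≉0 1≤roots =
    let (j , rⱼ) = count-witness (IsRoot? (member i)) 1≤roots
        (j′ , j≢j′ , rⱼ′) = second-point-root (member i) d≉0 j rⱼ in
    count≥2 (IsRoot? (member i)) j j′ j≢j′ rⱼ rⱼ′

  odd⇒degenerate⇒roots≥1 : ¬ two ≈ 0# → ∀ i → Degenerate i → 1 ≤ roots i
  odd⇒degenerate⇒roots≥1 two≉0 i d≈0 = decidable-stable (1 ℕ.≤? roots i) λ roots≱1 →
    odd-degenerate-has-root two≉0 (member i) d≈0 λ (j , rⱼ) → roots≱1 (count≥1 (IsRoot? (member i)) j rⱼ)

  Hyperbolic? : ∀ i → Dec (¬ Degenerate i × 1 ≤ roots i)
  Hyperbolic? i = ¬? (Degenerate? i) ×-dec (1 ℕ.≤? roots i)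

  Anisotropic? : ∀ i → Dec (¬ Degenerate i × ¬ 1 ≤ roots i)
  Anisotropic? i = ¬? (Degenerate? i) ×-dec ¬? (1 ℕ.≤? roots i)

  degenerate⇒discForm-root : ∀ i → Degenerate i → IsRoot (discForm s₁ s₂) i
  degenerate⇒discForm-root i d≈0 = trans (sym (disc-lincomb (px i) (py i) s₁ s₂)) d≈0

  degenerate-count≤2 : ¬ IsZero (discForm s₁ s₂) → count Degenerate? ≤ 2
  degenerate-count≤2 D≉0 = count≤2 Degenerate? λ i j k dᵢ dⱼ dₖ →
    roots≤2 (discForm s₁ s₂) D≉0 i j k (degenerate⇒discForm-root i dᵢ) (degenerate⇒discForm-root j dⱼ) (degenerate⇒discForm-root k dₖ)

  -- In characteristic 2, disc (a s₁ + b s₂) is the square of its XY-coefficient a b₁ + b b₂.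
  even⇒degenerate-count≤1 : two ≈ 0# → ¬ ((cXY s₁ ≈ 0#) × (cXY s₂ ≈ 0#)) → count Degenerate? ≤ 1
  even⇒degenerate-count≤1 two≈0 b₁b₂≉0 = count≤1 Degenerate? λ i i′ dᵢ dᵢ′ → case i Fin.≟ i′ of λ where
      (yes i≡i′) → i≡i′
      (no i≢i′)  → ⊥-elim (b₁b₂≉0 (det≉0⇒trivial-solution (point-independent i≢i′) (XY≈0 i dᵢ) (XY≈0 i′ dᵢ′)))
    where
    XY≈0 : ∀ i → Degenerate i → px i * cXY s₁ + py i * cXY s₂ ≈ 0#
    XY≈0 i d≈0 = ≈-stable (x*x≈0⇒¬¬x≈0 B (begin
      B * B                                 ≈⟨ solve 3 (λ A B C → B :* B := (B :* B :- (A :* C :+ A :* C :+ A :* C :+ A :* C)) :+ (:1 :+ :1) :* ((:1 :+ :1) :* (A :* C))) refl A B C ⟩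
      disc (member i) + two * (two * (A * C)) ≈⟨ +-cong d≈0 (*-congʳ two≈0) ⟩
      0# + 0# * (two * (A * C))             ≈⟨ solve 1 (λ x → :0 :+ :0 :* x := :0) refl (two * (A * C)) ⟩
      0#                                    ∎))
      where A = cXX (member i) ; B = cXY (member i) ; C = cYY (member i)

module ScaledMembers (F : FiniteField) (s₁ s₂ : BinForm (FiniteField.field′ F))
  (coprime : NoCommonFactor (FiniteField.field′ F) s₁ s₂) where
  open FiniteField F using (card) renaming (field′ to K)
  open Field K hiding (zero)
  open FieldFacts K
  open BinaryForms K
  open FiniteFieldFacts F
  open FinitePencil F s₁ s₂ coprime

  scaled : Carrier → Fin (suc card) → BinForm K
  scaled l i = lincomb K (l * px i) s₁ (l * py i) s₂

  scaled-disc≉0 : ∀ l i → ¬ l ≈ 0# → ¬ Degenerate i → ¬ disc (scaled l i) ≈ 0#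
  scaled-disc≉0 l i l≉0 d≉0 d≈0 =
    *-≉0 (*-≉0 l≉0 l≉0) d≉0 (trans (sym (disc-lincomb-scale l (px i) (py i) s₁ s₂)) d≈0)

  scaled-hyperbolic : ∀ l i → ¬ l ≈ 0# → ¬ Degenerate i × 1 ≤ roots i → IsHyperbolic K (scaled l i)
  scaled-hyperbolic l i l≉0 (d≉0 , 1≤roots) =
    let (j , rⱼ) = count-witness (IsRoot? (member i)) 1≤roots in
    root⇒hyperbolic (scaled l i) (scaled-disc≉0 l i l≉0 d≉0) j
      (trans (eval-lincomb-scale l (px i) (py i) s₁ s₂ (px j) (py j)) (trans (*-congˡ rⱼ) (zeroʳ l)))

  scaled-anisotropic : ∀ l i → ¬ l ≈ 0# → ¬ Degenerate i × ¬ 1 ≤ roots i → IsAnisotropicRank2 K (scaled l i)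
  scaled-anisotropic l i l≉0 (d≉0 , roots≱1) =
    rootless⇒anisotropic (scaled l i) (scaled-disc≉0 l i l≉0 d≉0) λ j rⱼ →
      roots≱1 (count≥1 (IsRoot? (member i)) j
        (x*y≈0⇒y≈0 l≉0 (trans (sym (eval-lincomb-scale l (px i) (py i) s₁ s₂ (px j) (py j))) rⱼ)))

module NatBounds where
  open import Data.Nat using (_+_; _*_)
  open import Data.Nat.Solver using (module +-*-Solver)
  open +-*-Solver using (solve; _:+_; _:*_; _:=_; con)

  q∸1≤x : ∀ {q x d} → suc q ≤ x + d → d ≤ 2 → q ∸ 1 ≤ x
  q∸1≤x {zero}          _ _   = z≤n
  q∸1≤x {suc q} {x} {d} h d≤2 = ℕ.+-cancelˡ-≤ 2 q x
    (ℕ.≤-trans h (ℕ.≤-trans (ℕ.+-monoʳ-≤ x d≤2) (ℕ.≤-reflexive (ℕ.+-comm x 2))))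

  m≤2A+D : ∀ {m H A D} → H + A + D ≡ m → 2 * H + D ≤ m → m ≤ 2 * A + D
  m≤2A+D {m} {H} {A} {D} H+A+D≡m 2H+D≤m = ℕ.+-cancelˡ-≤ m m (2 * A + D) (ℕ.≤-trans (ℕ.≤-reflexive (≡.trans
      (≡.cong (λ k → k + k) (≡.sym H+A+D≡m))
      (solve 3 (λ H A D → (H :+ A :+ D) :+ (H :+ A :+ D) := (con 2 :* H :+ D) :+ (con 2 :* A :+ D)) ≡.refl H A D)))
    (ℕ.+-monoˡ-≤ (2 * A + D) 2H+D≤m))

  m≤2A+2D : ∀ {m H A D} → H + A + D ≡ m → 2 * H ≤ m → m ≤ 2 * A + 2 * D
  m≤2A+2D {m} {H} {A} {D} H+A+D≡m 2H≤m = ℕ.+-cancelˡ-≤ m m (2 * A + 2 * D) (ℕ.≤-trans (ℕ.≤-reflexive (≡.trans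
      (≡.cong (λ k → k + k) (≡.sym H+A+D≡m))
      (solve 3 (λ H A D → (H :+ A :+ D) :+ (H :+ A :+ D) := con 2 :* H :+ (con 2 :* A :+ con 2 :* D)) ≡.refl H A D)))
    (ℕ.+-monoˡ-≤ (2 * A + 2 * D) 2H≤m))

  square-bound : ∀ {n m} → n ≤ 2 * m → n ^ 2 ≤ 2 * (m * n)
  square-bound {n} {m} n≤2m = ℕ.≤-trans (ℕ.≤-reflexive (≡.cong (n *_) (ℕ.*-identityʳ n)))
    (ℕ.≤-trans (ℕ.*-monoˡ-≤ n n≤2m) (ℕ.≤-reflexive (ℕ.*-assoc 2 m n)))

module PencilCounting (F : FiniteField) (s₁ s₂ : BinForm (FiniteField.field′ F))
  (coprime : NoCommonFactor (FiniteField.field′ F) s₁ s₂) where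
  open FiniteField F using (card) renaming (field′ to K)
  open Field K using (_≈_; 0#)
  open FieldFacts K using (two)
  open FinitePencil F s₁ s₂ coprime
  open FiniteFieldFacts F using (_≟_)
  open NatBounds
  open import Data.Nat using (_+_; _*_)
  open ℕ.≤-Reasoning

  H A D : ℕ
  H = count Hyperbolic?
  A = count Anisotropic?
  D = count Degenerate?

  H+A+D≡q+1 : H + A + D ≡ suc card
  H+A+D≡q+1 = ≡.trans (≡.cong (_+ D) (≡.sym (∑-distrib-+ (indicator ∘ Hyperbolic?) (indicator ∘ Anisotropic?))))
    (≡.trans (≡.sym (∑-distrib-+ (λ i → indicator (Hyperbolic? i) + indicator (Anisotropic? i)) (indicator ∘ Degenerate?)))
    (≡.trans (sum-cong (λ i → indicator-partition (Degenerate? i) (1 ℕ.≤? roots i))) (sum-ones (suc card))))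

  ∑2[H]+[D]≡2H+D : sum (λ i → 2 * indicator (Hyperbolic? i) + indicator (Degenerate? i)) ≡ 2 * H + D
  ∑2[H]+[D]≡2H+D = ≡.trans (∑-distrib-+ (λ i → 2 * indicator (Hyperbolic? i)) (indicator ∘ Degenerate?))
                           (≡.cong (_+ D) (sum-*ˡ 2 (indicator ∘ Hyperbolic?)))

  q+1≤2H+D : suc card ≤ 2 * H + D
  q+1≤2H+D = begin
    suc card                                                     ≡⟨ ≡.sym ∑roots≡q+1 ⟩
    sum roots                                                    ≤⟨ sum-mono-≤ (λ i → ≤-indicators (roots i) (Degenerate? i) (1 ℕ.≤? roots i)
                                                                      (degenerate⇒roots≤1 i) (roots-member≤2 i)) ⟩
    sum (λ i → 2 * indicator (Hyperbolic? i) + indicator (Degenerate? i)) ≡⟨ ∑2[H]+[D]≡2H+D ⟩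
    2 * H + D                                                    ∎

  2H≤q+1 : 2 * H ≤ suc card
  2H≤q+1 = begin
    2 * H                                       ≡⟨ ≡.sym (sum-*ˡ 2 (indicator ∘ Hyperbolic?)) ⟩
    sum (λ i → 2 * indicator (Hyperbolic? i))   ≤⟨ sum-mono-≤ (λ i → indicators-≤ (roots i) (Degenerate? i) (1 ℕ.≤? roots i)
                                                     (nondegenerate⇒roots≢1 i)) ⟩
    sum roots                                   ≡⟨ ∑roots≡q+1 ⟩
    suc card                                    ∎

  odd⇒2H+D≤q+1 : ¬ two ≈ 0# → 2 * H + D ≤ suc card
  odd⇒2H+D≤q+1 two≉0 = begin
    2 * H + D                                                    ≡⟨ ≡.sym ∑2[H]+[D]≡2H+D ⟩
    sum (λ i → 2 * indicator (Hyperbolic? i) + indicator (Degenerate? i)) ≤⟨ sum-mono-≤ (λ i → indicators-≤′ (roots i) (Degenerate? i) (1 ℕ.≤? roots i)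
                                                                      (nondegenerate⇒roots≢1 i) (odd⇒degenerate⇒roots≥1 two≉0 i)) ⟩
    sum roots                                                    ≡⟨ ∑roots≡q+1 ⟩
    suc card                                                     ∎

  bounds : MaxRankIs2 K s₁ s₂ → (card ∸ 1 ≤ 2 * H) × (card ∸ 1 ≤ 2 * A)
  bounds r≡2 with two ≟ 0#
  ... | yes two≈0 = q∸1≤x q+1≤2H+D (ℕ.≤-trans D≤1 (s≤s z≤n))
                  , q∸1≤x (m≤2A+2D {H = H} {A} {D} H+A+D≡q+1 2H≤q+1) (ℕ.*-monoʳ-≤ 2 D≤1)
    where
    D≤1 : D ≤ 1
    D≤1 = even⇒degenerate-count≤1 two≈0 (MaximalRank.even⇒XY≉0 s₁ s₂ r≡2 two≈0)
  ... | no two≉0  = q∸1≤x q+1≤2H+D D≤2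
                  , q∸1≤x (m≤2A+D {H = H} {A} {D} H+A+D≡q+1 (odd⇒2H+D≤q+1 two≉0)) D≤2
    where
    D≤2 : D ≤ 2
    D≤2 = degenerate-count≤2 (MaximalRank.odd⇒discForm≉0 s₁ s₂ r≡2 two≉0)

open import Data.Nat using (_*_)

lemma21 : (F : FiniteField) →
    (s₁ s₂ : BinForm (FiniteField.field′ F)) →
    NoCommonFactor (FiniteField.field′ F) s₁ s₂ →
    MaxRankIs2 (FiniteField.field′ F) s₁ s₂ →
    (Σ ℕ λ n → ((FiniteField.card F ∸ 1) ^ 2 ≤ 2 * n) ×
    AtLeastPairs (FiniteField.field′ F) n (IsHyperbolic (FiniteField.field′ F)) s₁ s₂)
    × (Σ ℕ λ n → ((FiniteField.card F ∸ 1) ^ 2 ≤ 2 * n) ×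
    AtLeastPairs (FiniteField.field′ F) n (IsAnisotropicRank2 (FiniteField.field′ F)) s₁ s₂)
lemma21 F s₁ s₂ coprime r≡2 =
    (H * N , bound {H} (proj₁ (bounds r≡2)) , scaled-points Hyperbolic? (IsHyperbolic K) s₁ s₂ scaled-hyperbolic)
  , (A * N , bound {A} (proj₂ (bounds r≡2)) , scaled-points Anisotropic? (IsAnisotropicRank2 K) s₁ s₂ scaled-anisotropic)
  where
  open ScaledPoints F
  open FinitePencil F s₁ s₂ coprime
  open ScaledMembers F s₁ s₂ coprime
  open PencilCounting F s₁ s₂ coprime
  open FiniteField F using (card) renaming (field′ to K)

  N : ℕ
  N = count NonZero?

  bound : ∀ {m} → card ∸ 1 ≤ 2 * m → (card ∸ 1) ^ 2 ≤ 2 * (m * N)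
  bound {m} q∸1≤2m = ≡.subst (λ k → (card ∸ 1) ^ 2 ≤ 2 * (m * k)) (≡.sym #nonzero≡q∸1)
                             (NatBounds.square-bound {card ∸ 1} {m} q∸1≤2m)
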